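{- Every threshold graph with at least one edge is $\mathcal{H}$-integral, i.e., all eigenvalues of its Helmholtzian matrix are integers.
   Context: A threshold graph is a finite simple graph containing none of $2K_2$, $P_4$, $C_4$ as an induced subgraph (equivalently, one built from a single vertex by repeatedly adding an isolated vertex or a vertex adjacent to all existing vertices). Fix an orientation of every edge (tail $e^-$, head $e^+$) and a cyclic orientation of every triangle. $\mathcal{B}$ is the $|E|\times|V|$ matrix with $b_{ev}=-1$ if $v=e^-$, $1$ if $v=e^+$, $0$ otherwise; $\mathcal{C}$ is the $|T|\times|E|$ matrix ($T$ the set of triangles) with $c_{\vartriangle e}=\pm1$ if $e$ is an edge of $\vartriangle$ (sign $+$ iff the orientation of $e$ agrees with that of $\vartriangle$) and $0$ otherwise. The Helmholtzian matrix is $\mathcal{H}(G)=\mathcal{B}\mathcal{B}^{\intercal}+\mathcal{C}^{\intercal}\mathcal{C}$; its eigenvalues do not depend on the chosen orientations. -}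

module Defs where

open import Data.Bool using (Bool; true; false; _∧_; not; if_then_else_)
open import Data.Nat as ℕ using (ℕ; zero; suc; _<ᵇ_; _≡ᵇ_)
open import Data.Fin using (Fin; toℕ; punchIn)
import Data.Fin as Fin
open import Data.Integer using (ℤ; +_; -_; _-_; 1ℤ; 0ℤ)
import Data.Integer as ℤ
open import Data.List using (List; []; _∷_; length; lookup; filterᵇ; allFin; cartesianProduct; map)
open import Data.Product using (_×_; _,_; proj₁; proj₂; Σ; ∃)
open import Relation.Binary.PropositionalEquality using (_≡_; _≢_)
open import Relation.Nullary using (¬_)

Graph : ℕ → Set
Graph n = Fin n → Fin n → Bool

IsSimpleGraph : ∀ {n} → Graph n → Set
IsSimpleGraph {n} G = (∀ u v → G u v ≡ G v u) × (∀ v → G v v ≡ false)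

Adj : ∀ {n} → Graph n → Fin n → Fin n → Set
Adj G u v = G u v ≡ true

NonAdj : ∀ {n} → Graph n → Fin n → Fin n → Set
NonAdj G u v = G u v ≡ false

Distinct4 : ∀ {n} → Fin n → Fin n → Fin n → Fin n → Set
Distinct4 a b c d = a ≢ b × a ≢ c × a ≢ d × b ≢ c × b ≢ d × c ≢ d

Induced2K2 : ∀ {n} → Graph n → Fin n → Fin n → Fin n → Fin n → Set
Induced2K2 G a b c d =
  Adj G a b × Adj G c d × NonAdj G a c × NonAdj G a d × NonAdj G b c × NonAdj G b d

InducedP4 : ∀ {n} → Graph n → Fin n → Fin n → Fin n → Fin n → Set
InducedP4 G a b c d =
  Adj G a b × Adj G b c × Adj G c d × NonAdj G a c × NonAdj G a d × NonAdj G b d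

InducedC4 : ∀ {n} → Graph n → Fin n → Fin n → Fin n → Fin n → Set
InducedC4 G a b c d =
  Adj G a b × Adj G b c × Adj G c d × Adj G d a × NonAdj G a c × NonAdj G b d

IsThreshold : ∀ {n} → Graph n → Set
IsThreshold {n} G = ∀ (a b c d : Fin n) → Distinct4 a b c d →
  ¬ Induced2K2 G a b c d × ¬ InducedP4 G a b c d × ¬ InducedC4 G a b c d

HasEdge : ∀ {n} → Graph n → Set
HasEdge {n} G = Σ (Fin n) λ u → Σ (Fin n) λ v → Adj G u v

_<F_ : ∀ {n} → Fin n → Fin n → Bool
i <F j = toℕ i <ᵇ toℕ j

_=F_ : ∀ {n} → Fin n → Fin n → Bool
i =F j = toℕ i ≡ᵇ toℕ j

-- Edges: pairs (i , j) with i < j adjacent; oriented tail i, head j.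
edges : ∀ {n} → Graph n → List (Fin n × Fin n)
edges {n} G = filterᵇ (λ p → (proj₁ p <F proj₂ p) ∧ G (proj₁ p) (proj₂ p))
                      (cartesianProduct (allFin n) (allFin n))

-- Triangles: triples i < j < k pairwise adjacent; cyclic orientation i → j → k → i.
triangles : ∀ {n} → Graph n → List (Fin n × Fin n × Fin n)
triangles {n} G =
  filterᵇ (λ t → let i = proj₁ t ; j = proj₁ (proj₂ t) ; k = proj₂ (proj₂ t) in
                 (i <F j) ∧ (j <F k) ∧ G i j ∧ G j k ∧ G i k)
          (cartesianProduct (allFin n) (cartesianProduct (allFin n) (allFin n)))

nE : ∀ {n} → Graph n → ℕ
nE G = length (edges G)

nT : ∀ {n} → Graph n → ℕ
nT G = length (triangles G)

Mat : ℕ → ℕ → Set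
Mat m k = Fin m → Fin k → ℤ

sumFin : ∀ k → (Fin k → ℤ) → ℤ
sumFin zero f = 0ℤ
sumFin (suc k) f = f Fin.zero ℤ.+ sumFin k (λ i → f (Fin.suc i))

prodFin : ∀ k → (Fin k → ℤ) → ℤ
prodFin zero f = 1ℤ
prodFin (suc k) f = f Fin.zero ℤ.* prodFin k (λ i → f (Fin.suc i))

matMul : ∀ {m k l} → Mat m k → Mat k l → Mat m l
matMul {k = k} A B i j = sumFin k (λ r → A i r ℤ.* B r j)

transpose : ∀ {m k} → Mat m k → Mat k m
transpose A i j = A j i

matAdd : ∀ {m k} → Mat m k → Mat m k → Mat m k
matAdd A B i j = A i j ℤ.+ B i j

incB : ∀ {n} (G : Graph n) → Mat (nE G) n
incB G e v with lookup (edges G) e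
... | (t , h) = if v =F t then - 1ℤ else (if v =F h then 1ℤ else 0ℤ)

-- Triangle-edge matrix 𝓒 (|T| × |E|): ±1 if e is an edge of the triangle,
-- sign + iff orientation of e agrees with the cyclic orientation i → j → k → i.
incC : ∀ {n} (G : Graph n) → Mat (nT G) (nE G)
incC G t e with lookup (triangles G) t | lookup (edges G) e
... | (i , j , k) | (a , b) =
  if (a =F i) ∧ (b =F j) then 1ℤ
  else if (a =F j) ∧ (b =F k) then 1ℤ
  else if (a =F i) ∧ (b =F k) then - 1ℤ
  else 0ℤ

helmholtzian : ∀ {n} (G : Graph n) → Mat (nE G) (nE G)
helmholtzian G = matAdd (matMul (incB G) (transpose (incB G)))
                        (matMul (transpose (incC G)) (incC G))

det : ∀ k → Mat k k → ℤ
det zero M = 1ℤ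
det (suc k) M = sumFin (suc k) λ j →
  sgn (toℕ j) ℤ.* (M Fin.zero j ℤ.* det k (λ r c → M (Fin.suc r) (punchIn j c)))
  where
  sgn : ℕ → ℤ
  sgn zero = 1ℤ
  sgn (suc zero) = - 1ℤ
  sgn (suc (suc m)) = sgn m

charPolyAt : ∀ k → Mat k k → ℤ → ℤ
charPolyAt k M x = det k (λ i j → (if i =F j then x else 0ℤ) ℤ.- M i j)

-- All eigenvalues of M (roots of its characteristic polynomial, with
-- multiplicity) are integers: the characteristic polynomial factors as
-- ∏ (x - λᵢ) with λᵢ ∈ ℤ. (Equality of two integer polynomials is
-- tested on all integer arguments, which is equivalent.)
AllEigenvaluesIntegral : ∀ k → Mat k k → Set
AllEigenvaluesIntegral k M =
  Σ (Fin k → ℤ) λ λs → ∀ (x : ℤ) → charPolyAt k M x ≡ prodFin k (λ i → x ℤ.- λs i)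

IsHIntegral : ∀ {n} → Graph n → Set
IsHIntegral G = AllEigenvaluesIntegral (nE G) (helmholtzian G)

{-# OPTIONS --safe #-}
-- A threshold graph with at least one vertex has a dominating or an isolated
-- vertex: if a vertex v of maximum degree is not dominating, every
-- non-neighbour w of v is isolated, for a neighbour x of w would have larger
-- degree than v unless some neighbour y ≠ x of v is not adjacent to x, and then
-- v y x w is an alternating 4-cycle, inducing 2K₂, P₄ or C₄. Induct on the
-- number of vertices, deleting such a vertex v. If v is isolated, 𝓗(G) is
-- 𝓗(G − v) on the same edges. If v is dominating, listing the edges of G − v
-- before the edges at v makes 𝓗(G) block lower triangular with diagonal blocks
-- 𝓗(G − v) + I and J + L(G − v) + I, where L is the Laplacian and J the
-- all-ones matrix. So the induction also carries the spectra of L and J + L;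
-- both have constant row sums, and splitting off the all-ones eigenvector
-- leaves L(G − v) if v is isolated and J + L(G − v) + I if v is dominating.
-- Changing the enumeration or the orientation of the edges conjugates 𝓗 by a
-- signed permutation, so the order used in each step is harmless.

module Submission where

open import Defs
open import Data.Bool using (Bool; true; false; if_then_else_; T; _∧_)
open import Data.Bool.Properties as Boolₚ using (T-≡; T-∧)
open import Data.Empty using (⊥; ⊥-elim)
open import Data.Fin using (Fin; zero; suc; toℕ; punchIn; punchOut; fromℕ<; _↑ˡ_; _↑ʳ_; _≟_)
import Data.Fin.Properties as Finₚ
open import Data.Integer using (ℤ; -_; _+_; _*_; _-_; 0ℤ; 1ℤ; _≤_; +≤+; ≢-nonZero)
import Data.Integer.Properties as ℤₚ
open import Data.Integer.Tactic.RingSolver using (solve-∀)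
open import Data.List as List using (List; []; _∷_; lookup; length; filterᵇ; cartesianProduct; allFin; tabulate; map)
open import Data.List.Extrema ℤₚ.≤-totalOrder using (argmax; f[xs]≤f[argmax])
open import Data.List.Membership.Propositional using (_∈_)
open import Data.List.Membership.Propositional.Properties using (∈-lookup; ∈-filter⁺; ∈-cartesianProduct⁺; ∈-allFin)
import Data.List.Relation.Unary.All as All
open import Data.List.Relation.Unary.All.Properties using (all-filter)
import Data.List.Relation.Unary.AllPairs as AllPairs
import Data.List.Relation.Unary.Any as Any
open import Data.List.Relation.Unary.Any.Properties using (lookup-index)
open import Data.List.Relation.Unary.Unique.Propositional using (Unique)
import Data.List.Relation.Unary.Unique.Propositional.Properties as Uniqueₚ
open import Data.Nat as ℕ using (ℕ; zero; suc; s≤s; _<ᵇ_)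
import Data.Nat.Properties as ℕₚ
open import Data.Product using (Σ; _,_; proj₁; proj₂; _×_)
open import Data.Sum using (_⊎_; inj₁; inj₂)
open import Data.Vec.Functional using (updateAt; insertAt; _++_)
open import Data.Vec.Functional.Properties
  using (updateAt-updates; updateAt-minimal; updateAt-id-local; updateAt-commutes; insertAt-lookup; insertAt-punchIn; lookup-++ˡ; lookup-++ʳ)
open import Function using (_∘_; id; const; Injective; Equivalence)
open import Relation.Binary.Definitions using (tri<; tri≈; tri>)
open import Relation.Binary.PropositionalEquality
open import Relation.Nullary using (¬_; yes; no)
open import Relation.Nullary.Decidable using (T?; _×-dec_; ¬?)

private
  variable
    k m n : ℕ

infix 4 _≗ᴹ_
_≗ᴹ_ : ∀ {m k} → Mat m k → Mat m k → Set
A ≗ᴹ B = ∀ i j → A i j ≡ B i j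

=F-refl : (i : Fin n) → (i =F i) ≡ true
=F-refl i = Equivalence.to T-≡ (ℕₚ.≡⇒≡ᵇ (toℕ i) (toℕ i) refl)

=F⇒≡ : {i j : Fin n} → (i =F j) ≡ true → i ≡ j
=F⇒≡ {i = i} {j} e = Finₚ.toℕ-injective (ℕₚ.≡ᵇ⇒≡ (toℕ i) (toℕ j) (Equivalence.from T-≡ e))

≢⇒=F-false : {i j : Fin n} → i ≢ j → (i =F j) ≡ false
≢⇒=F-false {i = i} {j} i≢j with i =F j in e
... | true = ⊥-elim (i≢j (=F⇒≡ e))
... | false = refl

δ : Fin n → Fin n → ℤ
δ i j = if i =F j then 1ℤ else 0ℤ

δ-refl : (i : Fin n) → δ i i ≡ 1ℤ
δ-refl i rewrite =F-refl i = refl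

δ-≢ : {i j : Fin n} → i ≢ j → δ i j ≡ 0ℤ
δ-≢ i≢j rewrite ≢⇒=F-false i≢j = refl

δ-sym : (i j : Fin n) → δ i j ≡ δ j i
δ-sym i j with i ≟ j
... | yes refl = refl
... | no i≢j = trans (δ-≢ i≢j) (sym (δ-≢ (i≢j ∘ sym)))

δ-injective : ∀ {m n} {g : Fin m → Fin n} → Injective _≡_ _≡_ g → ∀ i j → δ (g i) (g j) ≡ δ i j
δ-injective {g = g} g-inj i j with i ≟ j
... | yes refl = trans (δ-refl (g i)) (sym (δ-refl i))
... | no i≢j = trans (δ-≢ (i≢j ∘ g-inj)) (sym (δ-≢ i≢j))

if-=F≡*δ : (i j : Fin n) (x : ℤ) → (if i =F j then x else 0ℤ) ≡ x * δ i j
if-=F≡*δ i j x with i =F j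
... | true = sym (ℤₚ.*-identityʳ x)
... | false = sym (ℤₚ.*-zeroʳ x)

sumFin-cong : ∀ k {f g : Fin k → ℤ} → (∀ i → f i ≡ g i) → sumFin k f ≡ sumFin k g
sumFin-cong zero f≗g = refl
sumFin-cong (suc k) f≗g = cong₂ _+_ (f≗g zero) (sumFin-cong k (f≗g ∘ suc))

sumFin-0 : ∀ k {f : Fin k → ℤ} → (∀ i → f i ≡ 0ℤ) → sumFin k f ≡ 0ℤ
sumFin-0 zero f≗0 = refl
sumFin-0 (suc k) f≗0 = cong₂ _+_ (f≗0 zero) (sumFin-0 k (f≗0 ∘ suc))

sumFin-+ : ∀ k (f g : Fin k → ℤ) → sumFin k (λ i → f i + g i) ≡ sumFin k f + sumFin k g
sumFin-+ zero f g = refl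
sumFin-+ (suc k) f g = trans (cong (f zero + g zero +_) (sumFin-+ k (f ∘ suc) (g ∘ suc)))
  (interchange (f zero) (g zero) _ _)
  where
  interchange : ∀ a b c d → a + b + (c + d) ≡ a + c + (b + d)
  interchange = solve-∀

sumFin-neg : ∀ k (f : Fin k → ℤ) → sumFin k (λ i → - f i) ≡ - sumFin k f
sumFin-neg zero f = refl
sumFin-neg (suc k) f = trans (cong (- f zero +_) (sumFin-neg k (f ∘ suc))) (sym (ℤₚ.neg-distrib-+ (f zero) _))

sumFin-*ˡ : ∀ k (c : ℤ) (f : Fin k → ℤ) → sumFin k (λ i → c * f i) ≡ c * sumFin k f
sumFin-*ˡ zero c f = sym (ℤₚ.*-zeroʳ c)
sumFin-*ˡ (suc k) c f = trans (cong (c * f zero +_) (sumFin-*ˡ k c (f ∘ suc))) (sym (ℤₚ.*-distribˡ-+ c _ _))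

sumFin-*ʳ : ∀ k (c : ℤ) (f : Fin k → ℤ) → sumFin k (λ i → f i * c) ≡ sumFin k f * c
sumFin-*ʳ k c f = trans (sumFin-cong k (λ i → ℤₚ.*-comm (f i) c)) (trans (sumFin-*ˡ k c f) (ℤₚ.*-comm c _))

sumFin-comm : ∀ a b (f : Fin a → Fin b → ℤ) →
  sumFin a (λ i → sumFin b (f i)) ≡ sumFin b (λ j → sumFin a (λ i → f i j))
sumFin-comm zero b f = sym (sumFin-0 b (λ _ → refl))
sumFin-comm (suc a) b f = trans (cong (sumFin b (f zero) +_) (sumFin-comm a b (f ∘ suc)))
  (sym (sumFin-+ b (f zero) _))

sumFin-punchIn : ∀ k (j : Fin (suc k)) (f : Fin (suc k) → ℤ) →
  sumFin (suc k) f ≡ f j + sumFin k (f ∘ punchIn j)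
sumFin-punchIn k zero f = refl
sumFin-punchIn (suc k) (suc j) f =
  trans (cong (f zero +_) (sumFin-punchIn k j (f ∘ suc))) (exchange (f zero) (f (suc j)) _)
  where
  exchange : ∀ a b c → a + (b + c) ≡ b + (a + c)
  exchange = solve-∀

sumFin-single : ∀ k (j : Fin k) (f : Fin k → ℤ) → (∀ i → i ≢ j → f i ≡ 0ℤ) → sumFin k f ≡ f j
sumFin-single (suc k) j f vanish = trans (sumFin-punchIn k j f)
  (trans (cong (f j +_) (sumFin-0 k (λ i → vanish (punchIn j i) (Finₚ.punchInᵢ≢i j i)))) (ℤₚ.+-identityʳ (f j)))

sumFin-δˡ : ∀ k (j : Fin k) (f : Fin k → ℤ) → sumFin k (λ i → δ j i * f i) ≡ f j
sumFin-δˡ k j f = trans (sumFin-single k j _ (λ i i≢j → cong (_* f i) (δ-≢ (i≢j ∘ sym))))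
  (trans (cong (_* f j) (δ-refl j)) (ℤₚ.*-identityˡ (f j)))

sumFin-δʳ : ∀ k (j : Fin k) (f : Fin k → ℤ) → sumFin k (λ i → f i * δ i j) ≡ f j
sumFin-δʳ k j f = trans (sumFin-cong k (λ i → trans (ℤₚ.*-comm (f i) _) (cong (_* f i) (δ-sym i j)))) (sumFin-δˡ k j f)

sumFin-↑ : ∀ a b (f : Fin (a ℕ.+ b) → ℤ) → sumFin (a ℕ.+ b) f ≡ sumFin a (f ∘ (_↑ˡ b)) + sumFin b (f ∘ (a ↑ʳ_))
sumFin-↑ zero b f = sym (ℤₚ.+-identityˡ _)
sumFin-↑ (suc a) b f = trans (cong (f zero +_) (sumFin-↑ a b (f ∘ suc))) (sym (ℤₚ.+-assoc (f zero) _ _))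

sumFin-mono-≤ : ∀ k {f g : Fin k → ℤ} → (∀ i → f i ≤ g i) → sumFin k f ≤ sumFin k g
sumFin-mono-≤ zero f≤g = ℤₚ.≤-refl
sumFin-mono-≤ (suc k) f≤g = ℤₚ.+-mono-≤ (f≤g zero) (sumFin-mono-≤ k (f≤g ∘ suc))

prodFin-cong : ∀ k {f g : Fin k → ℤ} → (∀ i → f i ≡ g i) → prodFin k f ≡ prodFin k g
prodFin-cong zero f≗g = refl
prodFin-cong (suc k) f≗g = cong₂ _*_ (f≗g zero) (prodFin-cong k (f≗g ∘ suc))

prodFin-↑ : ∀ a b (f : Fin (a ℕ.+ b) → ℤ) → prodFin (a ℕ.+ b) f ≡ prodFin a (f ∘ (_↑ˡ b)) * prodFin b (f ∘ (a ↑ʳ_))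
prodFin-↑ zero b f = sym (ℤₚ.*-identityˡ _)
prodFin-↑ (suc a) b f = trans (cong (f zero *_) (prodFin-↑ a b (f ∘ suc))) (sym (ℤₚ.*-assoc (f zero) _ _))

-- Laplace expansion

minor : Mat (suc k) (suc k) → Fin (suc k) → Mat k k
minor M j r c = M (suc r) (punchIn j c)

sign : ℕ → ℤ
sign zero = 1ℤ
sign (suc zero) = - 1ℤ
sign (suc (suc n)) = sign n

sign-suc : ∀ n → sign (suc n) ≡ - sign n
sign-suc zero = refl
sign-suc (suc zero) = refl
sign-suc (suc (suc n)) = sign-suc n

laplaceTerm : Mat (suc k) (suc k) → Fin (suc k) → ℤ
laplaceTerm {k} M j = sign (toℕ j) * (M zero j * det k (minor M j))

period₂-≡ : ∀ {a} {A : Set a} (f g : ℕ → A) → f 0 ≡ g 0 → f 1 ≡ g 1 →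
  (∀ n → f n ≡ g n → f (suc (suc n)) ≡ g (suc (suc n))) → ∀ n → f n ≡ g n
period₂-≡ f g e₀ e₁ step zero = e₀
period₂-≡ f g e₀ e₁ step (suc zero) = e₁
period₂-≡ f g e₀ e₁ step (suc (suc n)) = step n (period₂-≡ f g e₀ e₁ step n)

-- The sign used by Defs.det is local to its where block, so it cannot be named:
-- the tail of the unfolded expansion is captured by unification, and then
-- compared with laplaceTerm, which has period 2 in the column index.
det-expand : ∀ k (M : Mat (suc k) (suc k)) → det (suc k) M ≡ sumFin (suc k) (laplaceTerm M)
det-expand k M = trans (proj₂ unfolded) (cong (laplaceTerm M zero +_) (sumFin-cong k tail≡laplaceTerm))
  where
  unfolded : Σ (Fin k → ℤ) λ t → det (suc k) M ≡ laplaceTerm M zero + sumFin k t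
  unfolded = _ , refl
  period₂-at : ∀ i n → _ ≡ sign (suc n) * (M zero (suc i) * det k (minor M (suc i)))
  period₂-at i = period₂-≡ _ _ refl refl (λ _ e → e)
  tail≡laplaceTerm : ∀ i → proj₁ unfolded i ≡ sign (suc (toℕ i)) * (M zero (suc i) * det k (minor M (suc i)))
  tail≡laplaceTerm i with toℕ i
  ... | n = period₂-at i n

det-cong : ∀ k {A B : Mat k k} → A ≗ᴹ B → det k A ≡ det k B
det-cong zero A≗B = refl
det-cong (suc k) {A} {B} A≗B = begin
  det (suc k) A               ≡⟨ det-expand k A ⟩
  sumFin (suc k) (laplaceTerm A) ≡⟨ sumFin-cong (suc k) term≡ ⟩
  sumFin (suc k) (laplaceTerm B) ≡⟨ det-expand k B ⟨
  det (suc k) B               ∎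
  where
  open ≡-Reasoning
  term≡ : ∀ j → laplaceTerm A j ≡ laplaceTerm B j
  term≡ j = cong₂ (λ a d → sign (toℕ j) * (a * d)) (A≗B zero j) (det-cong k (λ r c → A≗B (suc r) (punchIn j c)))

infixl 6 _[_]≔_
_[_]≔_ : ∀ {m k} → Mat m k → Fin m → (Fin k → ℤ) → Mat m k
A [ r ]≔ u = updateAt A r (const u)

≔-same : ∀ {m k} (A : Mat m k) r u → (A [ r ]≔ u) r ≡ u
≔-same A r u = updateAt-updates r A

≔-other : ∀ {m k} (A : Mat m k) {r i} u → i ≢ r → (A [ r ]≔ u) i ≡ A i
≔-other A {r} {i} u i≢r = updateAt-minimal i r A i≢r

≔-cong : ∀ {m k} {A B : Mat m k} r {u v : Fin k → ℤ} → A ≗ᴹ B → (∀ j → u j ≡ v j) → A [ r ]≔ u ≗ᴹ B [ r ]≔ v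
≔-cong r {u} {v} A≗B u≗v i j with i ≟ r
... | yes refl = trans (cong-app (≔-same _ i u) j) (trans (u≗v j) (sym (cong-app (≔-same _ i v) j)))
... | no i≢r = trans (cong-app (≔-other _ u i≢r) j) (trans (A≗B i j) (sym (cong-app (≔-other _ v i≢r) j)))

≔-self : ∀ {m k} (A : Mat m k) r → A [ r ]≔ A r ≗ᴹ A
≔-self A r i j = cong-app (updateAt-id-local r A refl i) j

≔-comm : ∀ {m k} (A : Mat m k) {r s} u v → r ≢ s → (A [ r ]≔ u) [ s ]≔ v ≗ᴹ (A [ s ]≔ v) [ r ]≔ u
≔-comm A {r} {s} u v r≢s i j = cong-app (updateAt-commutes s r (r≢s ∘ sym) A i) j

minor-≔ : ∀ {k} (A : Mat (suc k) (suc k)) r u j → minor (A [ suc r ]≔ u) j ≗ᴹ minor A j [ r ]≔ (u ∘ punchIn j)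
minor-≔ A r u j a c with a ≟ r
... | yes refl = trans (cong-app (≔-same (A ∘ suc) a u) (punchIn j c)) (sym (cong-app (≔-same (minor A j) a _) c))
... | no a≢r = trans (cong-app (≔-other (A ∘ suc) u a≢r) (punchIn j c)) (sym (cong-app (≔-other (minor A j) _ a≢r) c))

expansion-linear : ∀ {k} (A B C : Mat (suc k) (suc k)) (c : ℤ) →
  (∀ j → laplaceTerm A j ≡ c * laplaceTerm B j + laplaceTerm C j) →
  det (suc k) A ≡ c * det (suc k) B + det (suc k) C
expansion-linear {k} A B C c termwise = begin
  det (suc k) A                                                          ≡⟨ det-expand k A ⟩
  sumFin (suc k) (laplaceTerm A)                                         ≡⟨ sumFin-cong (suc k) termwise ⟩
  sumFin (suc k) (λ j → c * laplaceTerm B j + laplaceTerm C j)           ≡⟨ sumFin-+ (suc k) (λ j → c * laplaceTerm B j) (laplaceTerm C) ⟩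
  sumFin (suc k) (λ j → c * laplaceTerm B j) + sumFin (suc k) (laplaceTerm C)
    ≡⟨ cong₂ _+_ (trans (sumFin-*ˡ (suc k) c (laplaceTerm B)) (cong (c *_) (sym (det-expand k B)))) (sym (det-expand k C)) ⟩
  c * det (suc k) B + det (suc k) C                                      ∎
  where open ≡-Reasoning

det-linear : ∀ m (A : Mat m m) r (c : ℤ) (u w : Fin m → ℤ) →
  det m (A [ r ]≔ (λ j → c * u j + w j)) ≡ c * det m (A [ r ]≔ u) + det m (A [ r ]≔ w)
det-linear (suc m) A zero c u w =
  expansion-linear (A [ zero ]≔ (λ j → c * u j + w j)) (A [ zero ]≔ u) (A [ zero ]≔ w) c λ j →
  distrib c (sign (toℕ j)) (u j) (w j) (det m (minor A j))
  where
  distrib : ∀ c s x y d → s * ((c * x + y) * d) ≡ c * (s * (x * d)) + s * (y * d)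
  distrib = solve-∀
det-linear (suc m) A (suc r) c u w =
  expansion-linear (A [ suc r ]≔ v) (A [ suc r ]≔ u) (A [ suc r ]≔ w) c λ j → begin
  sign (toℕ j) * (A zero j * det m (minor (A [ suc r ]≔ v) j))
    ≡⟨ cong (λ d → sign (toℕ j) * (A zero j * d)) (trans (minor-det v j) (det-linear m (minor A j) r c _ _)) ⟩
  sign (toℕ j) * (A zero j * (c * restricted u j + restricted w j))
    ≡⟨ distrib c (sign (toℕ j)) (A zero j) _ _ ⟩
  c * (sign (toℕ j) * (A zero j * restricted u j)) + sign (toℕ j) * (A zero j * restricted w j)
    ≡⟨ cong₂ (λ x y → c * (sign (toℕ j) * (A zero j * x)) + sign (toℕ j) * (A zero j * y)) (sym (minor-det u j)) (sym (minor-det w j)) ⟩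
  c * laplaceTerm (A [ suc r ]≔ u) j + laplaceTerm (A [ suc r ]≔ w) j ∎
  where
  open ≡-Reasoning
  v : Fin (suc m) → ℤ
  v i = c * u i + w i
  restricted : (Fin (suc m) → ℤ) → Fin (suc m) → ℤ
  restricted z j = det m (minor A j [ r ]≔ (z ∘ punchIn j))
  minor-det : ∀ z j → det m (minor (A [ suc r ]≔ z) j) ≡ restricted z j
  minor-det z j = det-cong m (minor-≔ A r z j)
  distrib : ∀ c s a x y → s * (a * (c * x + y)) ≡ c * (s * (a * x)) + s * (a * y)
  distrib = solve-∀

-- Alternating multilinear forms and the product rule

record IsAlternatingMultilinear (m : ℕ) (f : Mat m m → ℤ) : Set where
  field
    respects-≗ᴹ : ∀ {A B} → A ≗ᴹ B → f A ≡ f B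
    linear : ∀ A r (c : ℤ) (u w : Fin m → ℤ) → f (A [ r ]≔ (λ j → c * u j + w j)) ≡ c * f (A [ r ]≔ u) + f (A [ r ]≔ w)
    alternating : ∀ A {r s} → r ≢ s → (∀ j → A r j ≡ A s j) → f A ≡ 0ℤ

swapRows : Mat m k → Fin m → Fin m → Mat m k
swapRows A r s = A [ r ]≔ A s [ s ]≔ A r

module AlternatingMultilinear {m} {f : Mat m m → ℤ} (P : IsAlternatingMultilinear m f) where
  open IsAlternatingMultilinear P

  zero-row : ∀ A r → f (A [ r ]≔ const 0ℤ) ≡ 0ℤ
  zero-row A r = begin
    f (A [ r ]≔ const 0ℤ)                                        ≡⟨ respects-≗ᴹ (≔-cong r (λ _ _ → refl) (λ _ → refl)) ⟩
    f (A [ r ]≔ (λ j → - 1ℤ * 0ℤ + 0ℤ))                           ≡⟨ linear A r (- 1ℤ) (const 0ℤ) (const 0ℤ) ⟩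
    - 1ℤ * f (A [ r ]≔ const 0ℤ) + f (A [ r ]≔ const 0ℤ)          ≡⟨ cong (_+ f (A [ r ]≔ const 0ℤ)) (ℤₚ.-1*i≡-i (f (A [ r ]≔ const 0ℤ))) ⟩
    - f (A [ r ]≔ const 0ℤ) + f (A [ r ]≔ const 0ℤ)               ≡⟨ ℤₚ.+-inverseˡ (f (A [ r ]≔ const 0ℤ)) ⟩
    0ℤ                                                            ∎
    where open ≡-Reasoning

  additive : ∀ A r (u w : Fin m → ℤ) → f (A [ r ]≔ (λ j → u j + w j)) ≡ f (A [ r ]≔ u) + f (A [ r ]≔ w)
  additive A r u w = begin
    f (A [ r ]≔ (λ j → u j + w j))          ≡⟨ respects-≗ᴹ (≔-cong r (λ _ _ → refl) (λ j → cong (_+ w j) (sym (ℤₚ.*-identityˡ (u j))))) ⟩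
    f (A [ r ]≔ (λ j → 1ℤ * u j + w j))     ≡⟨ linear A r 1ℤ u w ⟩
    1ℤ * f (A [ r ]≔ u) + f (A [ r ]≔ w)    ≡⟨ cong (_+ f (A [ r ]≔ w)) (ℤₚ.*-identityˡ (f (A [ r ]≔ u))) ⟩
    f (A [ r ]≔ u) + f (A [ r ]≔ w)         ∎
    where open ≡-Reasoning

  linear-sum : ∀ A r k (a : Fin k → ℤ) (V : Fin k → Fin m → ℤ) →
    f (A [ r ]≔ (λ c → sumFin k (λ j → a j * V j c))) ≡ sumFin k (λ j → a j * f (A [ r ]≔ V j))
  linear-sum A r zero a V = zero-row A r
  linear-sum A r (suc k) a V =
    trans (linear A r (a zero) (V zero) _) (cong (a zero * f (A [ r ]≔ V zero) +_) (linear-sum A r k (a ∘ suc) (V ∘ suc)))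

  repeated-row : ∀ A {r s} u → r ≢ s → f (A [ s ]≔ u [ r ]≔ u) ≡ 0ℤ
  repeated-row A {r} {s} u r≢s = alternating _ r≢s λ j →
    trans (cong-app (≔-same _ r u) j) (sym (cong-app (trans (≔-other _ u (r≢s ∘ sym)) (≔-same A s u)) j))

  add-row : ∀ A {r s} (c : ℤ) → r ≢ s → f (A [ r ]≔ (λ j → A r j + c * A s j)) ≡ f A
  add-row A {r} {s} c r≢s = begin
    f (A [ r ]≔ (λ j → A r j + c * A s j))                 ≡⟨ respects-≗ᴹ (≔-cong r (λ _ _ → refl) (λ j → ℤₚ.+-comm (A r j) _)) ⟩
    f (A [ r ]≔ (λ j → c * A s j + A r j))                 ≡⟨ linear A r c (A s) (A r) ⟩
    c * f (A [ r ]≔ A s) + f (A [ r ]≔ A r)                ≡⟨ cong₂ (λ x y → c * x + y) (respects-≗ᴹ same-row) (respects-≗ᴹ (≔-self A r)) ⟩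
    c * f (A [ s ]≔ A s [ r ]≔ A s) + f A                  ≡⟨ cong (λ x → c * x + f A) (repeated-row A (A s) r≢s) ⟩
    c * 0ℤ + f A                                            ≡⟨ cong (_+ f A) (ℤₚ.*-zeroʳ c) ⟩
    0ℤ + f A                                                ≡⟨ ℤₚ.+-identityˡ (f A) ⟩
    f A                                                     ∎
    where
    open ≡-Reasoning
    same-row : A [ r ]≔ A s ≗ᴹ A [ s ]≔ A s [ r ]≔ A s
    same-row = ≔-cong r (λ i j → sym (≔-self A s i j)) (λ _ → refl)

  swap : ∀ A {r s} → r ≢ s → f (swapRows A r s) ≡ - f A
  swap A {r} {s} r≢s = begin
    f (swapRows A r s)                                      ≡⟨ solve-neg (f (swapRows A r s)) (f A) ⟩
    - f A + (f (swapRows A r s) + f A)                      ≡⟨ cong (λ x → - f A + (x + f A)) (sym rows-Ar) ⟩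
    - f A + (f (A [ r ]≔ S [ s ]≔ A r) + f A)               ≡⟨ cong (λ x → - f A + (f (A [ r ]≔ S [ s ]≔ A r) + x)) (sym rows-As) ⟩
    - f A + (f (A [ r ]≔ S [ s ]≔ A r) + f (A [ r ]≔ S [ s ]≔ A s)) ≡⟨ cong (- f A +_) (sym (additive (A [ r ]≔ S) s (A r) (A s))) ⟩
    - f A + f (A [ r ]≔ S [ s ]≔ S)                         ≡⟨ cong (- f A +_) (repeated-row' S) ⟩
    - f A + 0ℤ                                              ≡⟨ ℤₚ.+-identityʳ (- f A) ⟩
    - f A                                                   ∎
    where
    open ≡-Reasoning
    S : Fin m → ℤ
    S j = A r j + A s j
    s≢r : s ≢ r
    s≢r = r≢s ∘ sym
    repeated-row' : ∀ u → f (A [ r ]≔ u [ s ]≔ u) ≡ 0ℤ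
    repeated-row' u = repeated-row A u s≢r
    split-r : ∀ v → f (A [ r ]≔ S [ s ]≔ v) ≡ f (A [ s ]≔ v [ r ]≔ A r) + f (A [ s ]≔ v [ r ]≔ A s)
    split-r v = trans (respects-≗ᴹ (≔-comm A S v r≢s)) (additive (A [ s ]≔ v) r (A r) (A s))
    rows-Ar : f (A [ r ]≔ S [ s ]≔ A r) ≡ f (swapRows A r s)
    rows-Ar = begin
      f (A [ r ]≔ S [ s ]≔ A r)                                  ≡⟨ split-r (A r) ⟩
      f (A [ s ]≔ A r [ r ]≔ A r) + f (A [ s ]≔ A r [ r ]≔ A s)  ≡⟨ cong (_+ f (A [ s ]≔ A r [ r ]≔ A s)) (repeated-row A (A r) r≢s) ⟩
      0ℤ + f (A [ s ]≔ A r [ r ]≔ A s)                          ≡⟨ ℤₚ.+-identityˡ _ ⟩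
      f (A [ s ]≔ A r [ r ]≔ A s)                               ≡⟨ respects-≗ᴹ (≔-comm A (A r) (A s) s≢r) ⟩
      f (swapRows A r s)                                        ∎
    rows-As : f (A [ r ]≔ S [ s ]≔ A s) ≡ f A
    rows-As = begin
      f (A [ r ]≔ S [ s ]≔ A s)                                  ≡⟨ split-r (A s) ⟩
      f (A [ s ]≔ A s [ r ]≔ A r) + f (A [ s ]≔ A s [ r ]≔ A s)  ≡⟨ cong (f (A [ s ]≔ A s [ r ]≔ A r) +_) (repeated-row A (A s) r≢s) ⟩
      f (A [ s ]≔ A s [ r ]≔ A r) + 0ℤ                          ≡⟨ ℤₚ.+-identityʳ _ ⟩
      f (A [ s ]≔ A s [ r ]≔ A r)                               ≡⟨ respects-≗ᴹ (≔-cong r (≔-self A s) (λ _ → refl)) ⟩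
      f (A [ r ]≔ A r)                                          ≡⟨ respects-≗ᴹ (≔-self A r) ⟩
      f A                                                       ∎
    solve-neg : ∀ x a → x ≡ - a + (x + a)
    solve-neg = solve-∀

toℕ-punchOut-< : {j c : Fin (suc n)} (j≢c : j ≢ c) → toℕ c ℕ.< toℕ j → toℕ (punchOut j≢c) ≡ toℕ c
toℕ-punchOut-< {_} {zero} {c} j≢c ()
toℕ-punchOut-< {suc n} {suc j} {zero} j≢c _ = refl
toℕ-punchOut-< {suc n} {suc j} {suc c} j≢c (s≤s c<j) = cong suc (toℕ-punchOut-< (j≢c ∘ cong suc) c<j)

toℕ-punchOut-> : {j c : Fin (suc n)} (j≢c : j ≢ c) → toℕ j ℕ.< toℕ c → suc (toℕ (punchOut j≢c)) ≡ toℕ c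
toℕ-punchOut-> {_} {zero} {zero} j≢c ()
toℕ-punchOut-> {_} {zero} {suc c} j≢c _ = refl
toℕ-punchOut-> {suc n} {suc j} {suc c} j≢c (s≤s j<c) = cong suc (toℕ-punchOut-> (j≢c ∘ cong suc) j<c)

punchIn-punchOut-comm : (j c : Fin (suc (suc n))) (j≢c : j ≢ c) (c≢j : c ≢ j) (x : Fin n) →
  punchIn j (punchIn (punchOut j≢c) x) ≡ punchIn c (punchIn (punchOut c≢j) x)
punchIn-punchOut-comm zero zero j≢c c≢j x = ⊥-elim (j≢c refl)
punchIn-punchOut-comm zero (suc c) j≢c c≢j x = refl
punchIn-punchOut-comm (suc j) zero j≢c c≢j x = refl
punchIn-punchOut-comm {suc n} (suc j) (suc c) j≢c c≢j zero = refl
punchIn-punchOut-comm {suc n} (suc j) (suc c) j≢c c≢j (suc x) =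
  cong suc (punchIn-punchOut-comm j c (j≢c ∘ cong suc) (c≢j ∘ cong suc) x)

sign-punchOut-antisym : (j c : Fin (suc n)) (j≢c : j ≢ c) (c≢j : c ≢ j) →
  sign (toℕ j) * sign (toℕ (punchOut j≢c)) ≡ - (sign (toℕ c) * sign (toℕ (punchOut c≢j)))
sign-punchOut-antisym j c j≢c c≢j with ℕₚ.<-cmp (toℕ j) (toℕ c)
... | tri≈ _ j≡c _ = ⊥-elim (j≢c (Finₚ.toℕ-injective j≡c))
... | tri< j<c _ _ = begin
  sign (toℕ j) * sign (toℕ (punchOut j≢c))
    ≡⟨ cong (λ n → sign n * sign (toℕ (punchOut j≢c))) (sym (toℕ-punchOut-< c≢j j<c)) ⟩
  sign (toℕ (punchOut c≢j)) * sign (toℕ (punchOut j≢c))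
    ≡⟨ antisym (sign (toℕ (punchOut c≢j))) (sign (toℕ (punchOut j≢c))) ⟩
  - (- sign (toℕ (punchOut j≢c)) * sign (toℕ (punchOut c≢j)))
    ≡⟨ cong (λ s → - (s * sign (toℕ (punchOut c≢j)))) (sym (sign-suc (toℕ (punchOut j≢c)))) ⟩
  - (sign (suc (toℕ (punchOut j≢c))) * sign (toℕ (punchOut c≢j)))
    ≡⟨ cong (λ n → - (sign n * sign (toℕ (punchOut c≢j)))) (toℕ-punchOut-> j≢c j<c) ⟩
  - (sign (toℕ c) * sign (toℕ (punchOut c≢j))) ∎
  where
  open ≡-Reasoning
  antisym : ∀ a b → a * b ≡ - (- b * a)
  antisym = solve-∀
... | tri> _ _ c<j = begin
  sign (toℕ j) * sign (toℕ (punchOut j≢c))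
    ≡⟨ cong (λ n → sign n * sign (toℕ (punchOut j≢c))) (sym (toℕ-punchOut-> c≢j c<j)) ⟩
  sign (suc (toℕ (punchOut c≢j))) * sign (toℕ (punchOut j≢c))
    ≡⟨ cong (_* sign (toℕ (punchOut j≢c))) (sign-suc (toℕ (punchOut c≢j))) ⟩
  - sign (toℕ (punchOut c≢j)) * sign (toℕ (punchOut j≢c))
    ≡⟨ antisym (sign (toℕ (punchOut c≢j))) (sign (toℕ (punchOut j≢c))) ⟩
  - (sign (toℕ (punchOut j≢c)) * sign (toℕ (punchOut c≢j)))
    ≡⟨ cong (λ n → - (sign n * sign (toℕ (punchOut c≢j)))) (toℕ-punchOut-< j≢c c<j) ⟩
  - (sign (toℕ c) * sign (toℕ (punchOut c≢j))) ∎
  where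
  open ≡-Reasoning
  antisym : ∀ a b → - a * b ≡ - (b * a)
  antisym = solve-∀

-- Expanding twice along the two equal rows gives a double sum over pairs of
-- distinct columns whose terms are antisymmetric in the pair, so it vanishes.
module DoubleExpansion (A : Mat (suc (suc n)) (suc (suc n))) (rows₀₁ : ∀ j → A zero j ≡ A (suc zero) j) where
  private
    N : ℕ
    N = suc (suc n)

    u : Fin N → ℤ
    u = A zero

    D : Fin N → Fin (suc n) → ℤ
    D j k = det n (minor (minor A j) k)

    term : Fin N → Fin (suc n) → ℤ
    term j k = sign (toℕ j) * (u j * (sign (toℕ k) * (u (punchIn j k) * D j k)))

    pairTerm : Fin N → Fin N → ℤ
    pairTerm j c with j ≟ c
    ... | yes _ = 0ℤ
    ... | no j≢c = term j (punchOut j≢c)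

    det≡double-sum : det N A ≡ sumFin N (λ j → sumFin (suc n) (term j))
    det≡double-sum = trans (det-expand (suc n) A) (sumFin-cong N λ j → begin
      sign (toℕ j) * (u j * det (suc n) (minor A j))
        ≡⟨ cong (λ d → sign (toℕ j) * (u j * d)) (trans (det-expand n (minor A j)) (sumFin-cong (suc n) (row₁≡row₀ j))) ⟩
      sign (toℕ j) * (u j * sumFin (suc n) (λ k → sign (toℕ k) * (u (punchIn j k) * D j k)))
        ≡⟨ cong (sign (toℕ j) *_) (sym (sumFin-*ˡ (suc n) (u j) (λ k → sign (toℕ k) * (u (punchIn j k) * D j k)))) ⟩
      sign (toℕ j) * sumFin (suc n) (λ k → u j * (sign (toℕ k) * (u (punchIn j k) * D j k)))
        ≡⟨ sym (sumFin-*ˡ (suc n) (sign (toℕ j)) (λ k → u j * (sign (toℕ k) * (u (punchIn j k) * D j k)))) ⟩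
      sumFin (suc n) (term j) ∎)
      where
      open ≡-Reasoning
      row₁≡row₀ : ∀ j k → laplaceTerm (minor A j) k ≡ sign (toℕ k) * (u (punchIn j k) * D j k)
      row₁≡row₀ j k = cong (λ a → sign (toℕ k) * (a * D j k)) (sym (rows₀₁ (punchIn j k)))

    pairTerm-diagonal : ∀ j → pairTerm j j ≡ 0ℤ
    pairTerm-diagonal j with j ≟ j
    ... | yes _ = refl
    ... | no j≢j = ⊥-elim (j≢j refl)

    pairTerm-punchIn : ∀ j k → pairTerm j (punchIn j k) ≡ term j k
    pairTerm-punchIn j k with j ≟ punchIn j k
    ... | yes j≡ = ⊥-elim (Finₚ.punchInᵢ≢i j k (sym j≡))
    ... | no j≢ = cong (term j) (trans (Finₚ.punchOut-cong j refl) (Finₚ.punchOut-punchIn j))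

    row-sum : ∀ j → sumFin (suc n) (term j) ≡ sumFin N (pairTerm j)
    row-sum j = sym (begin
      sumFin N (pairTerm j)                                            ≡⟨ sumFin-punchIn (suc n) j (pairTerm j) ⟩
      pairTerm j j + sumFin (suc n) (pairTerm j ∘ punchIn j)           ≡⟨ cong (_+ sumFin (suc n) (pairTerm j ∘ punchIn j)) (pairTerm-diagonal j) ⟩
      0ℤ + sumFin (suc n) (pairTerm j ∘ punchIn j)                     ≡⟨ ℤₚ.+-identityˡ _ ⟩
      sumFin (suc n) (pairTerm j ∘ punchIn j)                          ≡⟨ sumFin-cong (suc n) (pairTerm-punchIn j) ⟩
      sumFin (suc n) (term j)                                          ∎)
      where open ≡-Reasoning

    pairTerm-antisym : ∀ j c → pairTerm j c ≡ - pairTerm c j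
    pairTerm-antisym j c with j ≟ c | c ≟ j
    ... | yes _ | yes _ = refl
    ... | yes j≡c | no c≢j = ⊥-elim (c≢j (sym j≡c))
    ... | no j≢c | yes c≡j = ⊥-elim (j≢c (sym c≡j))
    ... | no j≢c | no c≢j = begin
        sign (toℕ j) * (u j * (sign (toℕ p) * (u (punchIn j p) * D j p)))
          ≡⟨ cong₂ (λ x d → sign (toℕ j) * (u j * (sign (toℕ p) * (u x * d)))) (Finₚ.punchIn-punchOut j≢c) D-comm ⟩
        sign (toℕ j) * (u j * (sign (toℕ p) * (u c * D c q)))
          ≡⟨ regroup (sign (toℕ j)) (sign (toℕ p)) (u j) (u c) (D c q) ⟩
        (sign (toℕ j) * sign (toℕ p)) * (u j * u c * D c q)
          ≡⟨ cong (_* (u j * u c * D c q)) (sign-punchOut-antisym j c j≢c c≢j) ⟩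
        - (sign (toℕ c) * sign (toℕ q)) * (u j * u c * D c q)
          ≡⟨ ungroup (sign (toℕ c)) (sign (toℕ q)) (u j) (u c) (D c q) ⟩
        - (sign (toℕ c) * (u c * (sign (toℕ q) * (u j * D c q))))
          ≡⟨ cong (λ x → - (sign (toℕ c) * (u c * (sign (toℕ q) * (u x * D c q))))) (sym (Finₚ.punchIn-punchOut c≢j)) ⟩
        - (sign (toℕ c) * (u c * (sign (toℕ q) * (u (punchIn c q) * D c q)))) ∎
      where
      open ≡-Reasoning
      p q : Fin (suc n)
      p = punchOut j≢c
      q = punchOut c≢j
      D-comm : D j p ≡ D c q
      D-comm = det-cong n (λ a b → cong (A (suc (suc a))) (punchIn-punchOut-comm j c j≢c c≢j b))
      regroup : ∀ s t x y d → s * (x * (t * (y * d))) ≡ (s * t) * (x * y * d)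
      regroup = solve-∀
      ungroup : ∀ s t x y d → - (s * t) * (x * y * d) ≡ - (s * (y * (t * (x * d))))
      ungroup = solve-∀

  det≡0 : det N A ≡ 0ℤ
  det≡0 = trans det≡double-sum (trans (sumFin-cong N row-sum) (x≡-x⇒x≡0 S≡-S))
    where
    S : ℤ
    S = sumFin N (λ j → sumFin N (pairTerm j))
    S≡-S : S ≡ - S
    S≡-S = trans (sumFin-comm N N pairTerm) (trans (sumFin-cong N (λ c → trans (sumFin-cong N (λ j → pairTerm-antisym j c))
      (sumFin-neg N (pairTerm c)))) (sumFin-neg N (λ c → sumFin N (pairTerm c))))
    x≡-x⇒x≡0 : ∀ {x} → x ≡ - x → x ≡ 0ℤ
    x≡-x⇒x≡0 {Data.Integer.+_ zero} _ = refl
    x≡-x⇒x≡0 {Data.Integer.+[1+ n ]} ()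
    x≡-x⇒x≡0 {Data.Integer.-[1+ n ]} ()

det-alternating : ∀ m (A : Mat m m) {r s} → r ≢ s → (∀ j → A r j ≡ A s j) → det m A ≡ 0ℤ
det-isAlternatingMultilinear : ∀ m → IsAlternatingMultilinear m (det m)
det-swapRows-suc : ∀ m (A : Mat (suc m) (suc m)) {r s} → r ≢ s → det (suc m) (swapRows A (suc r) (suc s)) ≡ - det (suc m) A
det-rows₀-suc : ∀ m (A : Mat (suc m) (suc m)) s → (∀ j → A zero j ≡ A (suc s) j) → det (suc m) A ≡ 0ℤ

det-isAlternatingMultilinear m = record
  { respects-≗ᴹ = det-cong m
  ; linear = det-linear m
  ; alternating = det-alternating m
  }

det-swapRows-suc m A {r} {s} r≢s = begin
  det (suc m) (swapRows A (suc r) (suc s))                     ≡⟨ det-expand m (swapRows A (suc r) (suc s)) ⟩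
  sumFin (suc m) (laplaceTerm (swapRows A (suc r) (suc s)))    ≡⟨ sumFin-cong (suc m) negated ⟩
  sumFin (suc m) (λ j → - laplaceTerm A j)                     ≡⟨ sumFin-neg (suc m) (laplaceTerm A) ⟩
  - sumFin (suc m) (laplaceTerm A)                             ≡⟨ cong -_ (det-expand m A) ⟨
  - det (suc m) A                                              ∎
  where
  open ≡-Reasoning
  minor-swap : ∀ j → minor (swapRows A (suc r) (suc s)) j ≗ᴹ swapRows (minor A j) r s
  minor-swap j a c = trans (minor-≔ (A [ suc r ]≔ A (suc s)) s (A (suc r)) j a c)
    (≔-cong s (minor-≔ A r (A (suc s)) j) (λ _ → refl) a c)
  negated : ∀ j → laplaceTerm (swapRows A (suc r) (suc s)) j ≡ - laplaceTerm A j
  negated j = trans (cong (λ d → sign (toℕ j) * (A zero j * d))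
      (trans (det-cong m (minor-swap j)) (AlternatingMultilinear.swap (det-isAlternatingMultilinear m) (minor A j) r≢s)))
    (push-neg (sign (toℕ j)) (A zero j) (det m (minor A j)))
    where
    push-neg : ∀ a b c → a * (b * - c) ≡ - (a * (b * c))
    push-neg = solve-∀

det-alternating zero A {()}
det-alternating (suc m) A {zero} {zero} r≢s _ = ⊥-elim (r≢s refl)
det-alternating (suc m) A {suc r} {zero} r≢s rows = det-rows₀-suc m A r (sym ∘ rows)
det-alternating (suc m) A {zero} {suc s} r≢s rows = det-rows₀-suc m A s rows
det-alternating (suc m) A {suc r} {suc s} r≢s rows = trans (det-expand m A) (sumFin-0 (suc m) λ j →
  trans (cong (λ d → sign (toℕ j) * (A zero j * d)) (det-alternating m (minor A j) (r≢s ∘ cong suc) (rows ∘ punchIn j)))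
    (annihilate (sign (toℕ j)) (A zero j)))
  where
  annihilate : ∀ a b → a * (b * 0ℤ) ≡ 0ℤ
  annihilate = solve-∀

det-rows₀-suc (suc n) A zero rows = DoubleExpansion.det≡0 A rows
det-rows₀-suc (suc n) A (suc s) rows = begin
  det (suc (suc n)) A                                          ≡⟨ ℤₚ.neg-involutive _ ⟨
  - - det (suc (suc n)) A                                      ≡⟨ cong -_ (det-swapRows-suc (suc n) A {zero} {suc s} (λ ())) ⟨
  - det (suc (suc n)) (swapRows A (suc zero) (suc (suc s)))    ≡⟨ cong -_ (DoubleExpansion.det≡0 (swapRows A (suc zero) (suc (suc s))) rows) ⟩
  - 0ℤ                                                          ≡⟨⟩
  0ℤ                                                            ∎
  where open ≡-Reasoning

identity : ∀ m → Mat m m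
identity m i j = δ i j

insertAt-≢ : ∀ {A : Set} (xs : Fin n → A) {j c : Fin (suc n)} v (j≢c : j ≢ c) → insertAt xs j v c ≡ xs (punchOut j≢c)
insertAt-≢ xs {j} v j≢c = trans (cong (insertAt xs j v) (sym (Finₚ.punchIn-punchOut j≢c))) (insertAt-punchIn xs j v _)

<ᵇ-irrefl : ∀ n → (n <ᵇ n) ≡ false
<ᵇ-irrefl zero = refl
<ᵇ-irrefl (suc n) = <ᵇ-irrefl n

<ᵇ-suc : ∀ n → (n <ᵇ suc n) ≡ true
<ᵇ-suc zero = refl
<ᵇ-suc (suc n) = <ᵇ-suc n

<ᵇ-suc-≢ : ∀ a t → a ≢ t → (a <ᵇ suc t) ≡ (a <ᵇ t)
<ᵇ-suc-≢ zero zero a≢t = ⊥-elim (a≢t refl)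
<ᵇ-suc-≢ zero (suc t) _ = refl
<ᵇ-suc-≢ (suc a) zero _ = refl
<ᵇ-suc-≢ (suc a) (suc t) a≢t = <ᵇ-suc-≢ a t (a≢t ∘ cong suc)

module RowClearing {m} {f : Mat (suc m) (suc m) → ℤ} (P : IsAlternatingMultilinear (suc m) f)
                   (X : Mat (suc m) (suc m)) (w : Fin m → ℤ) where
  open IsAlternatingMultilinear P
  open AlternatingMultilinear P

  clearedRows : ℕ → Mat (suc m) (suc m)
  clearedRows t zero = X zero
  clearedRows t (suc i) c = X (suc i) c + (if toℕ i <ᵇ t then w i else 0ℤ) * X zero c

  clearedRows-suc : ∀ {t} (t<m : t ℕ.< m) → let i₀ = fromℕ< t<m in
    clearedRows (suc t) ≗ᴹ clearedRows t [ suc i₀ ]≔ (λ c → clearedRows t (suc i₀) c + w i₀ * clearedRows t zero c)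
  clearedRows-suc {t} t<m zero c = refl
  clearedRows-suc {t} t<m (suc i) c with i ≟ fromℕ< t<m
  ... | yes refl rewrite Finₚ.toℕ-fromℕ< t<m | <ᵇ-suc t | <ᵇ-irrefl t =
    trans (insert-zero (X (suc i) c) (w i) (X zero c)) (sym (cong-app (≔-same (clearedRows t) (suc i) _) c))
    where
    insert-zero : ∀ x a y → x + a * y ≡ x + 0ℤ * y + a * y
    insert-zero = solve-∀
  ... | no i≢i₀ = trans (cong (λ b → X (suc i) c + (if b then w i else 0ℤ) * X zero c) (<ᵇ-suc-≢ (toℕ i) t toℕi≢t))
    (sym (cong-app (≔-other (clearedRows t) _ (i≢i₀ ∘ Finₚ.suc-injective)) c))
    where
    toℕi≢t : toℕ i ≢ t
    toℕi≢t e = i≢i₀ (Finₚ.toℕ-injective (trans e (sym (Finₚ.toℕ-fromℕ< t<m))))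

  clearedRows-invariant : ∀ t → t ℕ.≤ m → f (clearedRows t) ≡ f X
  clearedRows-invariant zero _ = respects-≗ᴹ λ
    { zero c → refl
    ; (suc i) c → trans (cong (X (suc i) c +_) (ℤₚ.*-zeroˡ (X zero c))) (ℤₚ.+-identityʳ (X (suc i) c))
    }
  clearedRows-invariant (suc t) t<m = begin
    f (clearedRows (suc t))  ≡⟨ respects-≗ᴹ (clearedRows-suc t<m) ⟩
    f (clearedRows t [ suc (fromℕ< t<m) ]≔ _) ≡⟨ add-row (clearedRows t) {suc (fromℕ< t<m)} {zero} (w (fromℕ< t<m)) (λ ()) ⟩
    f (clearedRows t)        ≡⟨ clearedRows-invariant t (ℕₚ.<⇒≤ t<m) ⟩
    f X                      ∎
    where open ≡-Reasoning

  clear : ∀ {Y} → (∀ c → Y zero c ≡ X zero c) → (∀ i c → Y (suc i) c ≡ X (suc i) c + w i * X zero c) → f Y ≡ f X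
  clear {Y} Y₀ Yₛ = trans (respects-≗ᴹ Y≗cleared) (clearedRows-invariant m ℕₚ.≤-refl)
    where
    Y≗cleared : Y ≗ᴹ clearedRows m
    Y≗cleared zero c = Y₀ c
    Y≗cleared (suc i) c = trans (Yₛ i c)
      (cong (λ b → X (suc i) c + (if b then w i else 0ℤ) * X zero c) (sym (Equivalence.to T-≡ (ℕₚ.<⇒<ᵇ (Finₚ.toℕ<n i)))))

embed : Fin (suc m) → Mat m m → Mat (suc m) (suc m)
embed j B zero = δ j
embed j B (suc i) = insertAt (B i) j 0ℤ

embed-≔ : ∀ j (B : Mat m m) r v → embed j (B [ r ]≔ v) ≗ᴹ embed j B [ suc r ]≔ insertAt v j 0ℤ
embed-≔ j B r v zero c = refl
embed-≔ j B r v (suc i) c with i ≟ r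
... | yes refl = trans (cong (λ row → insertAt row j 0ℤ c) (≔-same B i v))
                       (sym (cong-app (≔-same (embed j B) (suc i) (insertAt v j 0ℤ)) c))
... | no i≢r = trans (cong (λ row → insertAt row j 0ℤ c) (≔-other B v i≢r))
                     (sym (cong-app (≔-other (embed j B) (insertAt v j 0ℤ) (i≢r ∘ Finₚ.suc-injective)) c))

insertAt-cong : ∀ {xs ys : Fin n → ℤ} j v → (∀ x → xs x ≡ ys x) → ∀ c → insertAt xs j v c ≡ insertAt ys j v c
insertAt-cong {xs = xs} {ys} j v xs≗ys c with j ≟ c
... | yes refl = trans (insertAt-lookup xs j v) (sym (insertAt-lookup ys j v))
... | no j≢c = trans (insertAt-≢ xs v j≢c) (trans (xs≗ys _) (sym (insertAt-≢ ys v j≢c)))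

insertAt-linear : ∀ (a : ℤ) (u w : Fin n → ℤ) j c →
  insertAt (λ x → a * u x + w x) j 0ℤ c ≡ a * insertAt u j 0ℤ c + insertAt w j 0ℤ c
insertAt-linear a u w j c with j ≟ c
... | yes refl rewrite insertAt-lookup u j 0ℤ | insertAt-lookup w j 0ℤ = trans (insertAt-lookup _ j 0ℤ) (sym (vanish a))
  where
  vanish : ∀ a → a * 0ℤ + 0ℤ ≡ 0ℤ
  vanish = solve-∀
... | no j≢c rewrite insertAt-≢ u 0ℤ j≢c | insertAt-≢ w 0ℤ j≢c = insertAt-≢ _ 0ℤ j≢c

embed-isAlternatingMultilinear : ∀ {f : Mat (suc m) (suc m) → ℤ} → IsAlternatingMultilinear (suc m) f →
  ∀ j → IsAlternatingMultilinear m (f ∘ embed j)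
embed-isAlternatingMultilinear {m} {f} P j = record
  { respects-≗ᴹ = λ A≗B → respects-≗ᴹ (embed-cong A≗B)
  ; linear = embedded-linear
  ; alternating = λ A r≢s rows → alternating (embed j A) (r≢s ∘ Finₚ.suc-injective) (insertAt-cong j 0ℤ rows)
  }
  where
  open IsAlternatingMultilinear P
  embed-cong : ∀ {A B} → A ≗ᴹ B → embed j A ≗ᴹ embed j B
  embed-cong A≗B zero c = refl
  embed-cong A≗B (suc i) c = insertAt-cong j 0ℤ (A≗B i) c
  embedded-linear : ∀ A r (a : ℤ) (u w : Fin m → ℤ) →
    f (embed j (A [ r ]≔ (λ x → a * u x + w x))) ≡ a * f (embed j (A [ r ]≔ u)) + f (embed j (A [ r ]≔ w))
  embedded-linear A r a u w = begin
    f (embed j (A [ r ]≔ (λ x → a * u x + w x)))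
      ≡⟨ respects-≗ᴹ (λ i c → trans (embed-≔ j A r _ i c) (≔-cong (suc r) (λ _ _ → refl) (insertAt-linear a u w j) i c)) ⟩
    f (embed j A [ suc r ]≔ (λ c → a * insertAt u j 0ℤ c + insertAt w j 0ℤ c))
      ≡⟨ linear (embed j A) (suc r) a (insertAt u j 0ℤ) (insertAt w j 0ℤ) ⟩
    a * f (embed j A [ suc r ]≔ insertAt u j 0ℤ) + f (embed j A [ suc r ]≔ insertAt w j 0ℤ)
      ≡⟨ sym (cong₂ (λ x y → a * x + y) (respects-≗ᴹ (embed-≔ j A r u)) (respects-≗ᴹ (embed-≔ j A r w))) ⟩
    a * f (embed j (A [ r ]≔ u)) + f (embed j (A [ r ]≔ w)) ∎
    where open ≡-Reasoning

cycle : Fin (suc m) → Mat (suc m) (suc m)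
cycle j zero = δ j
cycle j (suc i) = δ (punchIn j i)

cycle-sign : ∀ m {f : Mat (suc m) (suc m) → ℤ} → IsAlternatingMultilinear (suc m) f →
  ∀ j → f (cycle j) ≡ sign (toℕ j) * f (identity (suc m))
cycle-sign m P zero = trans (IsAlternatingMultilinear.respects-≗ᴹ P (λ { zero c → refl ; (suc i) c → refl })) (sym (ℤₚ.*-identityˡ _))
cycle-sign (suc m) {f} P (suc j) = begin
  f (cycle (suc j))                                     ≡⟨ ℤₚ.neg-involutive _ ⟨
  - - f (cycle (suc j))                                 ≡⟨ cong -_ (AlternatingMultilinear.swap P (cycle (suc j)) {zero} {suc zero} (λ ())) ⟨
  - f (swapRows (cycle (suc j)) zero (suc zero))        ≡⟨ cong -_ (respects-≗ᴹ swapped) ⟩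
  - f (embed zero (cycle j))                            ≡⟨ cong -_ (cycle-sign m (embed-isAlternatingMultilinear P zero) j) ⟩
  - (sign (toℕ j) * f (embed zero (identity (suc m))))  ≡⟨ cong (λ x → - (sign (toℕ j) * x)) (respects-≗ᴹ embedded-identity) ⟩
  - (sign (toℕ j) * f (identity (suc (suc m))))         ≡⟨ ℤₚ.neg-distribˡ-* (sign (toℕ j)) _ ⟩
  - sign (toℕ j) * f (identity (suc (suc m)))           ≡⟨ cong (_* f (identity (suc (suc m)))) (sign-suc (toℕ j)) ⟨
  sign (suc (toℕ j)) * f (identity (suc (suc m)))       ∎
  where
  open ≡-Reasoning
  open IsAlternatingMultilinear P
  swapped : swapRows (cycle (suc j)) zero (suc zero) ≗ᴹ embed zero (cycle j)
  swapped zero c = refl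
  swapped (suc zero) zero = refl
  swapped (suc zero) (suc c) = refl
  swapped (suc (suc i)) zero = refl
  swapped (suc (suc i)) (suc c) = refl
  embedded-identity : embed zero (identity (suc m)) ≗ᴹ identity (suc (suc m))
  embedded-identity zero c = refl
  embedded-identity (suc i) zero = refl
  embedded-identity (suc i) (suc c) = refl

embed-identity : ∀ (j : Fin (suc m)) → embed j (identity m) ≗ᴹ cycle j
embed-identity j zero c = refl
embed-identity j (suc i) c with j ≟ c
... | yes refl = trans (insertAt-lookup (δ i) j 0ℤ) (sym (δ-≢ (Finₚ.punchInᵢ≢i j i)))
... | no j≢c = trans (insertAt-≢ (δ i) 0ℤ j≢c) (sym (trans (cong (δ (punchIn j i)) (sym (Finₚ.punchIn-punchOut j≢c)))
  (δ-injective (λ {x} {y} → Finₚ.punchIn-injective j x y) i (punchOut j≢c))))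

det-unique : ∀ m {f : Mat m m → ℤ} → IsAlternatingMultilinear m f → ∀ A → f A ≡ det m A * f (identity m)
det-unique zero P A = trans (IsAlternatingMultilinear.respects-≗ᴹ P (λ ())) (sym (ℤₚ.*-identityˡ _))
det-unique (suc m) {f} P A = begin
  f A                                                              ≡⟨ respects-≗ᴹ row₀-in-basis ⟩
  f (A [ zero ]≔ (λ c → sumFin (suc m) (λ j → A zero j * δ j c)))   ≡⟨ linear-sum A zero (suc m) (A zero) δ ⟩
  sumFin (suc m) (λ j → A zero j * f (A [ zero ]≔ δ j))            ≡⟨ sumFin-cong (suc m) basis-row ⟩
  sumFin (suc m) (λ j → laplaceTerm A j * f I)                      ≡⟨ sumFin-*ʳ (suc m) (f I) (laplaceTerm A) ⟩
  sumFin (suc m) (laplaceTerm A) * f I                              ≡⟨ cong (_* f I) (det-expand m A) ⟨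
  det (suc m) A * f I                                               ∎
  where
  open ≡-Reasoning
  open IsAlternatingMultilinear P
  open AlternatingMultilinear P
  I : Mat (suc m) (suc m)
  I = identity (suc m)
  row₀-in-basis : A ≗ᴹ A [ zero ]≔ (λ c → sumFin (suc m) (λ j → A zero j * δ j c))
  row₀-in-basis i c = sym (trans (≔-cong zero (λ _ _ → refl) (λ c → sumFin-δʳ (suc m) c (A zero)) i c) (≔-self A zero i c))
  cleared : ∀ j i c → embed j (minor A j) (suc i) c ≡ A (suc i) c + - A (suc i) j * δ j c
  cleared j i c with j ≟ c
  ... | yes refl rewrite δ-refl j = trans (insertAt-lookup _ j 0ℤ) (sym (cancel (A (suc i) j)))
    where
    cancel : ∀ x → x + - x * 1ℤ ≡ 0ℤ
    cancel = solve-∀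
  ... | no j≢c rewrite δ-≢ j≢c = trans (insertAt-≢ _ 0ℤ j≢c)
    (trans (cong (A (suc i)) (Finₚ.punchIn-punchOut j≢c)) (sym (drop (A (suc i) c) (A (suc i) j))))
    where
    drop : ∀ x y → x + - y * 0ℤ ≡ x
    drop = solve-∀
  basis-row : ∀ j → A zero j * f (A [ zero ]≔ δ j) ≡ laplaceTerm A j * f I
  basis-row j = begin
    A zero j * f (A [ zero ]≔ δ j)                            ≡⟨ cong (A zero j *_) (sym (RowClearing.clear P (A [ zero ]≔ δ j) (λ i → - A (suc i) j) (λ _ → refl) (cleared j))) ⟩
    A zero j * f (embed j (minor A j))                        ≡⟨ cong (A zero j *_) (det-unique m (embed-isAlternatingMultilinear P j) (minor A j)) ⟩
    A zero j * (det m (minor A j) * f (embed j (identity m)))  ≡⟨ cong (λ x → A zero j * (det m (minor A j) * x)) (respects-≗ᴹ (embed-identity j)) ⟩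
    A zero j * (det m (minor A j) * f (cycle j))               ≡⟨ cong (λ x → A zero j * (det m (minor A j) * x)) (cycle-sign m P j) ⟩
    A zero j * (det m (minor A j) * (sign (toℕ j) * f I))      ≡⟨ regroup (A zero j) (det m (minor A j)) (sign (toℕ j)) (f I) ⟩
    laplaceTerm A j * f I                                     ∎
    where
    regroup : ∀ a d s x → a * (d * (s * x)) ≡ s * (a * d) * x
    regroup = solve-∀

det-identity : ∀ m → det m (identity m) ≡ 1ℤ
det-identity zero = refl
det-identity (suc m) = trans (det-expand m (identity (suc m))) (trans (sumFin-single (suc m) zero _ off-diagonal) on-diagonal)
  where
  off-diagonal : ∀ j → j ≢ zero → laplaceTerm (identity (suc m)) j ≡ 0ℤ
  off-diagonal j j≢0 rewrite δ-≢ (j≢0 ∘ sym) = annihilate (sign (toℕ j)) (det m (minor (identity (suc m)) j))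
    where
    annihilate : ∀ s d → s * (0ℤ * d) ≡ 0ℤ
    annihilate = solve-∀
  on-diagonal : laplaceTerm (identity (suc m)) zero ≡ 1ℤ
  on-diagonal = trans (ℤₚ.*-identityˡ _) (trans (ℤₚ.*-identityˡ _) (trans (det-cong m (λ _ _ → refl)) (det-identity m)))

matMul-≔ : ∀ (A B : Mat m m) r v → matMul (A [ r ]≔ v) B ≗ᴹ matMul A B [ r ]≔ (λ c → sumFin m (λ k → v k * B k c))
matMul-≔ {m} A B r v i c with i ≟ r
... | yes refl = trans (sumFin-cong m (λ k → cong (λ row → row k * B k c) (≔-same A i v)))
                       (sym (cong-app (≔-same (matMul A B) i _) c))
... | no i≢r = trans (sumFin-cong m (λ k → cong (λ row → row k * B k c) (≔-other A v i≢r)))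
                     (sym (cong-app (≔-other (matMul A B) _ i≢r) c))

det-* : ∀ m (A B : Mat m m) → det m (matMul A B) ≡ det m A * det m B
det-* m A B = trans (det-unique m ·B-isAlternatingMultilinear A) (cong (det m A *_) (det-cong m (λ i j → sumFin-δˡ m i (λ k → B k j))))
  where
  ·B-isAlternatingMultilinear : IsAlternatingMultilinear m (λ A → det m (matMul A B))
  ·B-isAlternatingMultilinear = record
    { respects-≗ᴹ = λ A≗A′ → det-cong m (λ i j → sumFin-cong m (λ k → cong (_* B k j) (A≗A′ i k)))
    ; linear = linear
    ; alternating = λ A r≢s rows → det-alternating m (matMul A B) r≢s (λ j → sumFin-cong m (λ k → cong (_* B k j) (rows k)))
    }
    where
    distrib : ∀ c u w b → (c * u + w) * b ≡ c * (u * b) + w * b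
    distrib = solve-∀
    row-linear : ∀ c (u w : Fin m → ℤ) j → sumFin m (λ k → (c * u k + w k) * B k j) ≡ c * sumFin m (λ k → u k * B k j) + sumFin m (λ k → w k * B k j)
    row-linear c u w j = trans (sumFin-cong m (λ k → distrib c (u k) (w k) (B k j)))
      (trans (sumFin-+ m (λ k → c * (u k * B k j)) (λ k → w k * B k j)) (cong (_+ sumFin m (λ k → w k * B k j)) (sumFin-*ˡ m c (λ k → u k * B k j))))
    linear : ∀ A r c (u w : Fin m → ℤ) → det m (matMul (A [ r ]≔ (λ j → c * u j + w j)) B) ≡ c * det m (matMul (A [ r ]≔ u) B) + det m (matMul (A [ r ]≔ w) B)
    linear A r c u w = begin
      det m (matMul (A [ r ]≔ (λ j → c * u j + w j)) B)
        ≡⟨ det-cong m (λ i j → trans (matMul-≔ A B r _ i j) (≔-cong r (λ _ _ → refl) (row-linear c u w) i j)) ⟩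
      det m (matMul A B [ r ]≔ (λ j → c * sumFin m (λ k → u k * B k j) + sumFin m (λ k → w k * B k j)))
        ≡⟨ det-linear m (matMul A B) r c _ _ ⟩
      c * det m (matMul A B [ r ]≔ _) + det m (matMul A B [ r ]≔ _)
        ≡⟨ sym (cong₂ (λ x y → c * x + y) (det-cong m (matMul-≔ A B r u)) (det-cong m (matMul-≔ A B r w))) ⟩
      c * det m (matMul (A [ r ]≔ u) B) + det m (matMul (A [ r ]≔ w) B) ∎
      where open ≡-Reasoning

-- Characteristic polynomials with integer roots

charMatrix : ∀ k → ℤ → Mat k k → Mat k k
charMatrix k x M i j = x * δ i j - M i j

charPolyAt≡det : ∀ k M x → charPolyAt k M x ≡ det k (charMatrix k x M)
charPolyAt≡det k M x = det-cong k (λ i j → cong (_- M i j) (if-=F≡*δ i j x))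

integral-cong : ∀ k {M N : Mat k k} → M ≗ᴹ N → AllEigenvaluesIntegral k M → AllEigenvaluesIntegral k N
integral-cong k M≗N (λs , factors) = λs , λ x →
  trans (det-cong k (λ i j → cong (λ m → (if i =F j then x else 0ℤ) - m) (sym (M≗N i j)))) (factors x)

det-invertible : ∀ k (P Q : Mat k k) → matMul Q P ≗ᴹ identity k → det k P ≢ 0ℤ
det-invertible k P Q QP≗I detP≡0 = 1≢0 (begin
  1ℤ                     ≡⟨ det-identity k ⟨
  det k (identity k)     ≡⟨ det-cong k (λ i j → sym (QP≗I i j)) ⟩
  det k (matMul Q P)     ≡⟨ det-* k Q P ⟩
  det k Q * det k P      ≡⟨ cong (det k Q *_) detP≡0 ⟩
  det k Q * 0ℤ           ≡⟨ ℤₚ.*-zeroʳ (det k Q) ⟩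
  0ℤ                     ∎)
  where
  open ≡-Reasoning
  1≢0 : 1ℤ ≢ 0ℤ
  1≢0 ()

charMatrix-*ʳ : ∀ k x (M P : Mat k k) i j → matMul (charMatrix k x M) P i j ≡ x * P i j - matMul M P i j
charMatrix-*ʳ k x M P i j = trans (sumFin-cong k (λ r → distrib x (δ i r) (M i r) (P r j)))
  (trans (sumFin-+ k (λ r → x * (δ i r * P r j)) (λ r → - (M i r * P r j)))
  (cong₂ _+_ (trans (sumFin-*ˡ k x (λ r → δ i r * P r j)) (cong (x *_) (sumFin-δˡ k i (λ r → P r j)))) (sumFin-neg k (λ r → M i r * P r j))))
  where
  distrib : ∀ x d m p → (x * d - m) * p ≡ x * (d * p) + - (m * p)
  distrib = solve-∀

charMatrix-*ˡ : ∀ k x (T P : Mat k k) i j → matMul P (charMatrix k x T) i j ≡ x * P i j - matMul P T i j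
charMatrix-*ˡ k x T P i j = trans (sumFin-cong k (λ r → distrib x (δ r j) (T r j) (P i r)))
  (trans (sumFin-+ k (λ r → x * (P i r * δ r j)) (λ r → - (P i r * T r j)))
  (cong₂ _+_ (trans (sumFin-*ˡ k x (λ r → P i r * δ r j)) (cong (x *_) (sumFin-δʳ k j (P i)))) (sumFin-neg k (λ r → P i r * T r j))))
  where
  distrib : ∀ x d t p → p * (x * d - t) ≡ x * (p * d) + - (p * t)
  distrib = solve-∀

integral-similar : ∀ k (M T P Q : Mat k k) → matMul M P ≗ᴹ matMul P T → matMul Q P ≗ᴹ identity k →
  AllEigenvaluesIntegral k T → AllEigenvaluesIntegral k M
integral-similar k M T P Q MP≗PT QP≗I (λs , factors) = λs , λ x → begin
  charPolyAt k M x                ≡⟨ charPolyAt≡det k M x ⟩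
  det k (charMatrix k x M)        ≡⟨ ℤₚ.*-cancelʳ-≡ _ _ (det k P) {{≢-nonZero (det-invertible k P Q QP≗I)}} (charDet-similar x) ⟩
  det k (charMatrix k x T)        ≡⟨ charPolyAt≡det k T x ⟨
  charPolyAt k T x                ≡⟨ factors x ⟩
  prodFin k (λ i → x - λs i)      ∎
  where
  open ≡-Reasoning
  charDet-similar : ∀ x → det k (charMatrix k x M) * det k P ≡ det k (charMatrix k x T) * det k P
  charDet-similar x = begin
    det k (charMatrix k x M) * det k P         ≡⟨ det-* k (charMatrix k x M) P ⟨
    det k (matMul (charMatrix k x M) P)        ≡⟨ det-cong k (λ i j → trans (charMatrix-*ʳ k x M P i j)
                                                    (trans (cong (λ m → x * P i j - m) (MP≗PT i j)) (sym (charMatrix-*ˡ k x T P i j)))) ⟩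
    det k (matMul P (charMatrix k x T))        ≡⟨ det-* k P (charMatrix k x T) ⟩
    det k P * det k (charMatrix k x T)         ≡⟨ ℤₚ.*-comm (det k P) _ ⟩
    det k (charMatrix k x T) * det k P         ∎

integral-shift : ∀ k (M : Mat k k) (c : ℤ) → AllEigenvaluesIntegral k M → AllEigenvaluesIntegral k (λ i j → M i j + c * δ i j)
integral-shift k M c (λs , factors) = (λ i → λs i + c) , λ x → begin
  charPolyAt k (λ i j → M i j + c * δ i j) x                      ≡⟨ charPolyAt≡det k _ x ⟩
  det k (charMatrix k x (λ i j → M i j + c * δ i j))              ≡⟨ det-cong k (λ i j → shift x c (δ i j) (M i j)) ⟩
  det k (charMatrix k (x - c) M)                                  ≡⟨ charPolyAt≡det k M (x - c) ⟨
  charPolyAt k M (x - c)                                          ≡⟨ factors (x - c) ⟩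
  prodFin k (λ i → x - c - λs i)                                  ≡⟨ prodFin-cong k (λ i → reassoc x c (λs i)) ⟩
  prodFin k (λ i → x - (λs i + c))                                ∎
  where
  open ≡-Reasoning
  shift : ∀ x c d m → x * d - (m + c * d) ≡ (x - c) * d - m
  shift = solve-∀
  reassoc : ∀ x c a → x - c - a ≡ x - (a + c)
  reassoc = solve-∀

integral-empty : (M : Mat 0 0) → AllEigenvaluesIntegral 0 M
integral-empty M = (λ ()) , λ x → refl

punchIn-↑ˡ : ∀ {a} d (j : Fin (suc a)) (c : Fin a) → punchIn (j ↑ˡ d) (c ↑ˡ d) ≡ punchIn j c ↑ˡ d
punchIn-↑ˡ d zero c = refl
punchIn-↑ˡ d (suc j) zero = refl
punchIn-↑ˡ d (suc j) (suc c) = cong suc (punchIn-↑ˡ d j c)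

punchIn-↑ʳ : ∀ {a} d (j : Fin (suc a)) (c : Fin d) → punchIn (j ↑ˡ d) (a ↑ʳ c) ≡ suc a ↑ʳ c
punchIn-↑ʳ d zero c = refl
punchIn-↑ʳ {suc a} d (suc j) c = cong suc (punchIn-↑ʳ d j c)

↑ˡ≢↑ʳ : ∀ {a d} (i : Fin a) (j : Fin d) → i ↑ˡ d ≢ a ↑ʳ j
↑ˡ≢↑ʳ {a} {d} i j i≡j = ℕₚ.<-irrefl refl (ℕₚ.<-≤-trans (Finₚ.toℕ<n i)
  (subst (a ℕ.≤_) (trans (sym (Finₚ.toℕ-↑ʳ a j)) (trans (cong toℕ (sym i≡j)) (Finₚ.toℕ-↑ˡ i d))) (ℕₚ.m≤m+n a (toℕ j))))

UpperRightZero : ∀ a d → Mat (a ℕ.+ d) (a ℕ.+ d) → Set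
UpperRightZero a d T = ∀ i j → T (i ↑ˡ d) (a ↑ʳ j) ≡ 0ℤ

upperLeft : ∀ a d → Mat (a ℕ.+ d) (a ℕ.+ d) → Mat a a
upperLeft a d T i j = T (i ↑ˡ d) (j ↑ˡ d)

lowerRight : ∀ a d → Mat (a ℕ.+ d) (a ℕ.+ d) → Mat d d
lowerRight a d T i j = T (a ↑ʳ i) (a ↑ʳ j)

det-blockLowerTriangular : ∀ a d (T : Mat (a ℕ.+ d) (a ℕ.+ d)) → UpperRightZero a d T →
  det (a ℕ.+ d) T ≡ det a (upperLeft a d T) * det d (lowerRight a d T)
det-blockLowerTriangular zero d T _ = sym (ℤₚ.*-identityˡ _)
det-blockLowerTriangular (suc a) d T zeroBlock = begin
  det (suc a ℕ.+ d) T
    ≡⟨ det-expand (a ℕ.+ d) T ⟩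
  sumFin (suc a ℕ.+ d) (laplaceTerm T)
    ≡⟨ sumFin-↑ (suc a) d (laplaceTerm T) ⟩
  sumFin (suc a) (laplaceTerm T ∘ (_↑ˡ d)) + sumFin d (laplaceTerm T ∘ (suc a ↑ʳ_))
    ≡⟨ cong₂ _+_ (sumFin-cong (suc a) left-columns) (sumFin-0 d right-columns) ⟩
  sumFin (suc a) (λ j → laplaceTerm L j * det d R) + 0ℤ
    ≡⟨ ℤₚ.+-identityʳ _ ⟩
  sumFin (suc a) (λ j → laplaceTerm L j * det d R)
    ≡⟨ sumFin-*ʳ (suc a) (det d R) (laplaceTerm L) ⟩
  sumFin (suc a) (laplaceTerm L) * det d R
    ≡⟨ cong (_* det d R) (det-expand a L) ⟨
  det (suc a) L * det d R ∎
  where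
  open ≡-Reasoning
  L : Mat (suc a) (suc a)
  L = upperLeft (suc a) d T
  R : Mat d d
  R = lowerRight (suc a) d T
  right-columns : ∀ j → laplaceTerm T (suc a ↑ʳ j) ≡ 0ℤ
  right-columns j = trans (cong (λ t → sign (toℕ (suc a ↑ʳ j)) * (t * det (a ℕ.+ d) (minor T (suc a ↑ʳ j)))) (zeroBlock zero j))
    (annihilate (sign (toℕ (suc a ↑ʳ j))) (det (a ℕ.+ d) (minor T (suc a ↑ʳ j))))
    where
    annihilate : ∀ s x → s * (0ℤ * x) ≡ 0ℤ
    annihilate = solve-∀
  minor-blocks : ∀ j → det (a ℕ.+ d) (minor T (j ↑ˡ d)) ≡ det a (minor L j) * det d R
  minor-blocks j = trans
    (det-blockLowerTriangular a d (minor T (j ↑ˡ d)) (λ i c → trans (cong (T (suc (i ↑ˡ d))) (punchIn-↑ʳ d j c)) (zeroBlock (suc i) c)))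
    (cong₂ _*_ (det-cong a (λ i c → cong (T (suc (i ↑ˡ d))) (punchIn-↑ˡ d j c)))
               (det-cong d (λ i c → cong (T (suc (a ↑ʳ i))) (punchIn-↑ʳ d j c))))
  left-columns : ∀ j → laplaceTerm T (j ↑ˡ d) ≡ laplaceTerm L j * det d R
  left-columns j = trans (cong₂ (λ s x → sign s * (T zero (j ↑ˡ d) * x)) (Finₚ.toℕ-↑ˡ j d) (minor-blocks j))
    (regroup (sign (toℕ j)) (L zero j) (det a (minor L j)) (det d R))
    where
    regroup : ∀ s t x y → s * (t * (x * y)) ≡ s * (t * x) * y
    regroup = solve-∀

integral-blockLowerTriangular : ∀ a d (T : Mat (a ℕ.+ d) (a ℕ.+ d)) → UpperRightZero a d T →
  AllEigenvaluesIntegral a (upperLeft a d T) → AllEigenvaluesIntegral d (lowerRight a d T) →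
  AllEigenvaluesIntegral (a ℕ.+ d) T
integral-blockLowerTriangular a d T zeroBlock (λsₗ , factorsₗ) (λsᵣ , factorsᵣ) = λsₗ ++ λsᵣ , λ x → begin
  charPolyAt (a ℕ.+ d) T x
    ≡⟨ charPolyAt≡det (a ℕ.+ d) T x ⟩
  det (a ℕ.+ d) (charMatrix (a ℕ.+ d) x T)
    ≡⟨ det-blockLowerTriangular a d (charMatrix (a ℕ.+ d) x T) (charMatrix-zero x) ⟩
  det a (upperLeft a d (charMatrix (a ℕ.+ d) x T)) * det d (lowerRight a d (charMatrix (a ℕ.+ d) x T))
    ≡⟨ cong₂ _*_ (det-cong a (λ i j → cong (λ e → x * e - T (i ↑ˡ d) (j ↑ˡ d)) (δ-injective (Finₚ.↑ˡ-injective d _ _) i j)))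
                 (det-cong d (λ i j → cong (λ e → x * e - T (a ↑ʳ i) (a ↑ʳ j)) (δ-injective (Finₚ.↑ʳ-injective a _ _) i j))) ⟩
  det a (charMatrix a x (upperLeft a d T)) * det d (charMatrix d x (lowerRight a d T))
    ≡⟨ cong₂ _*_ (trans (sym (charPolyAt≡det a _ x)) (factorsₗ x)) (trans (sym (charPolyAt≡det d _ x)) (factorsᵣ x)) ⟩
  prodFin a (λ i → x - λsₗ i) * prodFin d (λ i → x - λsᵣ i)
    ≡⟨ sym (cong₂ _*_ (prodFin-cong a (λ i → cong (λ e → x - e) (lookup-++ˡ λsₗ λsᵣ i))) (prodFin-cong d (λ i → cong (λ e → x - e) (lookup-++ʳ λsₗ λsᵣ i)))) ⟩
  prodFin a (λ i → x - (λsₗ ++ λsᵣ) (i ↑ˡ d)) * prodFin d (λ i → x - (λsₗ ++ λsᵣ) (a ↑ʳ i))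
    ≡⟨ prodFin-↑ a d (λ i → x - (λsₗ ++ λsᵣ) i) ⟨
  prodFin (a ℕ.+ d) (λ i → x - (λsₗ ++ λsᵣ) i) ∎
  where
  open ≡-Reasoning
  charMatrix-zero : ∀ x → UpperRightZero a d (charMatrix (a ℕ.+ d) x T)
  charMatrix-zero x i j = trans (cong₂ (λ e t → x * e - t) (δ-≢ (↑ˡ≢↑ʳ i j)) (zeroBlock i j)) (vanish x)
    where
    vanish : ∀ x → x * 0ℤ - 0ℤ ≡ 0ℤ
    vanish = solve-∀

det-zeroColumn₀ : ∀ k (N : Mat (suc k) (suc k)) → (∀ i → N i zero ≡ 0ℤ) → det (suc k) N ≡ 0ℤ
laplaceTerm-zeroColumn₀ : ∀ k (N : Mat (suc k) (suc k)) → (∀ i → N (suc i) zero ≡ 0ℤ) → ∀ j → j ≢ zero → laplaceTerm N j ≡ 0ℤ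

det-zeroColumn₀ k N column₀ = trans (det-expand k N) (sumFin-0 (suc k) vanishing)
  where
  vanishing : ∀ j → laplaceTerm N j ≡ 0ℤ
  vanishing zero = cong (λ t → 1ℤ * (t * det k (minor N zero))) (column₀ zero)
  vanishing (suc j) = laplaceTerm-zeroColumn₀ k N (column₀ ∘ suc) (suc j) (λ ())

laplaceTerm-zeroColumn₀ k N column₀ zero j≢0 = ⊥-elim (j≢0 refl)
laplaceTerm-zeroColumn₀ (suc k) N column₀ (suc j) _ =
  trans (cong (λ d → sign (toℕ (suc j)) * (N zero (suc j) * d)) (det-zeroColumn₀ k (minor N (suc j)) column₀))
    (annihilate (sign (toℕ (suc j))) (N zero (suc j)))
  where
  annihilate : ∀ a b → a * (b * 0ℤ) ≡ 0ℤ
  annihilate = solve-∀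

det-column₀ : ∀ k (N : Mat (suc k) (suc k)) → (∀ i → N (suc i) zero ≡ 0ℤ) → det (suc k) N ≡ N zero zero * det k (minor N zero)
det-column₀ k N column₀ = trans (det-expand k N)
  (trans (sumFin-single (suc k) zero (laplaceTerm N) (laplaceTerm-zeroColumn₀ k N column₀)) (ℤₚ.*-identityˡ _))

integral-column₀ : ∀ k (N : Mat (suc k) (suc k)) → (∀ i → N (suc i) zero ≡ 0ℤ) →
  AllEigenvaluesIntegral k (minor N zero) → AllEigenvaluesIntegral (suc k) N
integral-column₀ k N column₀ (λs , factors) = λs′ , λ x → begin
  charPolyAt (suc k) N x                                         ≡⟨ charPolyAt≡det (suc k) N x ⟩
  det (suc k) (charMatrix (suc k) x N)                           ≡⟨ det-column₀ k (charMatrix (suc k) x N) (charMatrix-column₀ x) ⟩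
  (x * 1ℤ - N zero zero) * det k (minor (charMatrix (suc k) x N) zero)
    ≡⟨ cong₂ _*_ (cong (_- N zero zero) (ℤₚ.*-identityʳ x)) (trans (sym (charPolyAt≡det k (minor N zero) x)) (factors x)) ⟩
  (x - N zero zero) * prodFin k (λ i → x - λs i)                 ∎
  where
  open ≡-Reasoning
  λs′ : Fin (suc k) → ℤ
  λs′ zero = N zero zero
  λs′ (suc i) = λs i
  charMatrix-column₀ : ∀ x i → charMatrix (suc k) x N (suc i) zero ≡ 0ℤ
  charMatrix-column₀ x i = trans (cong (λ t → x * 0ℤ - t) (column₀ i)) (vanish x)
    where
    vanish : ∀ x → x * 0ℤ - 0ℤ ≡ 0ℤ
    vanish = solve-∀

reduceAt : Fin (suc n) → Mat (suc n) (suc n) → Mat n n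
reduceAt v M k i = M (punchIn v k) (punchIn v i) - M v (punchIn v i)

-- The all-ones vector is an eigenvector for the common row sum c; completing it
-- by the standard basis vectors off v puts M in block upper triangular form.
module ConstantRowSum (M : Mat (suc n) (suc n)) (c : ℤ) (v : Fin (suc n)) (rowSum : ∀ x → sumFin (suc n) (M x) ≡ c) where
  private
    p : Fin n → Fin (suc n)
    p = punchIn v

    P : Mat (suc n) (suc n)
    P x zero = 1ℤ
    P x (suc i) = δ (p i) x

    U : Mat (suc n) (suc n)
    U zero zero = c
    U (suc k) zero = 0ℤ
    U zero (suc i) = M v (p i)
    U (suc k) (suc i) = reduceAt v M k i

    Q : Mat (suc n) (suc n)
    Q zero x = δ v x
    Q (suc k) x = δ (p k) x - δ v x

    δp-sum-v : ∀ (f : Fin n → ℤ) → sumFin n (λ k → δ (p k) v * f k) ≡ 0ℤ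
    δp-sum-v f = sumFin-0 n (λ k → cong (_* f k) (δ-≢ (Finₚ.punchInᵢ≢i v k)))

    δp-sum-≢ : ∀ (f : Fin n → ℤ) {x} (v≢x : v ≢ x) → sumFin n (λ k → δ (p k) x * f k) ≡ f (punchOut v≢x)
    δp-sum-≢ f {x} v≢x = trans (sumFin-cong n (λ k → cong (_* f k) (begin
        δ (p k) x                          ≡⟨ cong (δ (p k)) (Finₚ.punchIn-punchOut v≢x) ⟨
        δ (p k) (p (punchOut v≢x))         ≡⟨ δ-injective (λ {a} {b} → Finₚ.punchIn-injective v a b) k _ ⟩
        δ k (punchOut v≢x)                 ≡⟨ δ-sym k _ ⟩
        δ (punchOut v≢x) k                 ∎)))
      (sumFin-δˡ n (punchOut v≢x) f)
      where open ≡-Reasoning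

    MP≗PT : matMul M P ≗ᴹ matMul P U
    MP≗PT x zero = begin
      sumFin (suc n) (λ y → M x y * 1ℤ)                        ≡⟨ sumFin-cong (suc n) (λ y → ℤₚ.*-identityʳ (M x y)) ⟩
      sumFin (suc n) (M x)                                     ≡⟨ rowSum x ⟩
      c                                                        ≡⟨ ℤₚ.*-identityˡ c ⟨
      1ℤ * c                                                   ≡⟨ ℤₚ.+-identityʳ (1ℤ * c) ⟨
      1ℤ * c + 0ℤ                                              ≡⟨ cong (1ℤ * c +_) (sumFin-0 n (λ k → ℤₚ.*-zeroʳ (δ (p k) x))) ⟨
      1ℤ * c + sumFin n (λ k → δ (p k) x * 0ℤ)                 ∎
      where open ≡-Reasoning
    MP≗PT x (suc i) = begin
      sumFin (suc n) (λ y → M x y * δ (p i) y)                 ≡⟨ sumFin-cong (suc n) (λ y → cong (M x y *_) (δ-sym (p i) y)) ⟩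
      sumFin (suc n) (λ y → M x y * δ y (p i))                 ≡⟨ sumFin-δʳ (suc n) (p i) (M x) ⟩
      M x (p i)                                                ≡⟨ lower-rows x ⟨
      1ℤ * M v (p i) + sumFin n (λ k → δ (p k) x * reduceAt v M k i) ∎
      where
      open ≡-Reasoning
      lower-rows : ∀ x → 1ℤ * M v (p i) + sumFin n (λ k → δ (p k) x * reduceAt v M k i) ≡ M x (p i)
      lower-rows x with v ≟ x
      ... | yes refl = trans (cong (1ℤ * M v (p i) +_) (δp-sum-v (λ k → reduceAt v M k i)))
                         (trans (ℤₚ.+-identityʳ _) (ℤₚ.*-identityˡ _))
      ... | no v≢x = trans (cong (1ℤ * M v (p i) +_) (δp-sum-≢ (λ k → reduceAt v M k i) v≢x))
                       (trans (cong (λ y → 1ℤ * M v (p i) + (M y (p i) - M v (p i))) (Finₚ.punchIn-punchOut v≢x))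
                         (telescope (M v (p i)) (M x (p i))))
        where
        telescope : ∀ a b → 1ℤ * a + (b - a) ≡ b
        telescope = solve-∀

    QP≗I : matMul Q P ≗ᴹ identity (suc n)
    QP≗I zero zero = trans (sumFin-cong (suc n) (λ x → ℤₚ.*-identityʳ (δ v x)))
      (trans (sym (sumFin-cong (suc n) (λ x → ℤₚ.*-identityʳ (δ v x)))) (sumFin-δˡ (suc n) v (λ _ → 1ℤ)))
    QP≗I zero (suc i) = trans (sumFin-δˡ (suc n) v (δ (p i))) (δ-≢ (Finₚ.punchInᵢ≢i v i))
    QP≗I (suc k) j = trans (sumFin-cong (suc n) (λ x → distrib (δ (p k) x) (δ v x) (P x j)))
      (trans (sumFin-+ (suc n) (λ x → δ (p k) x * P x j) (λ x → - (δ v x * P x j)))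
      (trans (cong₂ _+_ (sumFin-δˡ (suc n) (p k) (λ x → P x j))
                        (trans (sumFin-neg (suc n) (λ x → δ v x * P x j)) (cong -_ (sumFin-δˡ (suc n) v (λ x → P x j)))))
      (columns j)))
      where
      distrib : ∀ a b d → (a - b) * d ≡ a * d + - (b * d)
      distrib = solve-∀
      columns : ∀ j → P (p k) j + - P v j ≡ identity (suc n) (suc k) j
      columns zero = refl
      columns (suc i) = begin
        δ (p i) (p k) + - δ (p i) v    ≡⟨ cong₂ (λ a b → a + - b) (δ-injective (λ {a} {b} → Finₚ.punchIn-injective v a b) i k) (δ-≢ (Finₚ.punchInᵢ≢i v i)) ⟩
        δ i k + - 0ℤ                   ≡⟨ ℤₚ.+-identityʳ (δ i k) ⟩
        δ i k                          ≡⟨ δ-sym i k ⟩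
        δ k i                          ∎
        where open ≡-Reasoning

  integral : AllEigenvaluesIntegral n (reduceAt v M) → AllEigenvaluesIntegral (suc n) M
  integral reduced = integral-similar (suc n) M U P Q MP≗PT QP≗I (integral-column₀ n U (λ _ → refl) reduced)

-- The Helmholtzian of an edge enumeration

indicator : Bool → ℤ
indicator true = 1ℤ
indicator false = 0ℤ

Edge : ℕ → Set
Edge n = Fin n × Fin n

-- ⟨∂(a → b), ∂(c → d)⟩, the entry of 𝓑𝓑ᵀ.
boundaryProduct : (a b c d : Fin n) → ℤ
boundaryProduct a b c d = δ a c - δ a d - δ b c + δ b d

-- The coefficient of c → d in the oriented cycle a → b → w → a.
cycleCoefficient : (a b w c d : Fin n) → ℤ
cycleCoefficient a b w c d = δ c a * δ d b + δ c b * δ d w + δ c w * δ d a - δ c b * δ d a - δ c w * δ d b - δ c a * δ d w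

trianglePart : Graph n → (a b c d : Fin n) → ℤ
trianglePart {n} G a b c d = sumFin n (λ w → indicator (G w a) * indicator (G w b) * cycleCoefficient a b w c d)

helmholtzEntry : Graph n → (a b c d : Fin n) → ℤ
helmholtzEntry G a b c d = boundaryProduct a b c d + trianglePart G a b c d

helmholtzEdge : Graph n → Edge n → Edge n → ℤ
helmholtzEdge G e f = helmholtzEntry G (proj₁ e) (proj₂ e) (proj₁ f) (proj₂ f)

helmholtzianOf : Graph n → (Fin m → Edge n) → Mat m m
helmholtzianOf G ed i j = helmholtzEdge G (ed i) (ed j)

orientation : (a b c d : Fin n) → ℤ
orientation a b c d = δ a c * δ b d - δ a d * δ b c

SameEdge : Edge n → Edge n → Set
SameEdge e f = (proj₁ e ≡ proj₁ f × proj₂ e ≡ proj₂ f) ⊎ (proj₁ e ≡ proj₂ f × proj₂ e ≡ proj₁ f)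

SameEdge-sym : ∀ {e f : Edge n} → SameEdge e f → SameEdge f e
SameEdge-sym (inj₁ (a≡c , b≡d)) = inj₁ (sym a≡c , sym b≡d)
SameEdge-sym (inj₂ (a≡d , b≡c)) = inj₂ (sym b≡c , sym a≡d)

SameEdge-trans : ∀ {e f g : Edge n} → SameEdge e f → SameEdge f g → SameEdge e g
SameEdge-trans (inj₁ (p , q)) (inj₁ (r , s)) = inj₁ (trans p r , trans q s)
SameEdge-trans (inj₁ (p , q)) (inj₂ (r , s)) = inj₂ (trans p r , trans q s)
SameEdge-trans (inj₂ (p , q)) (inj₁ (r , s)) = inj₂ (trans p s , trans q r)
SameEdge-trans (inj₂ (p , q)) (inj₂ (r , s)) = inj₁ (trans p s , trans q r)

record IsEdgeEnumeration (G : Graph n) (m : ℕ) (ed : Fin m → Edge n) : Set where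
  field
    adjacent : ∀ i → Adj G (proj₁ (ed i)) (proj₂ (ed i))
    covering : ∀ a b → Adj G a b → Σ (Fin m) λ i → SameEdge (ed i) (a , b)
    unique : ∀ i j → SameEdge (ed i) (ed j) → i ≡ j

orientation-distinct : ∀ (a b c d : Fin n) → ¬ SameEdge (a , b) (c , d) → orientation a b c d ≡ 0ℤ
orientation-distinct a b c d distinct = cong₂ _-_ (product-vanishes (distinct ∘ inj₁)) (product-vanishes (distinct ∘ inj₂))
  where
  product-vanishes : ∀ {a c b d : Fin n} → ¬ (a ≡ c × b ≡ d) → δ a c * δ b d ≡ 0ℤ
  product-vanishes {a = a} {c} {b} {d} ¬same with a ≟ c | b ≟ d
  ... | yes a≡c | yes b≡d = ⊥-elim (¬same (a≡c , b≡d))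
  ... | no a≢c | _ = cong (_* δ b d) (δ-≢ a≢c)
  ... | yes _ | no b≢d = trans (cong (δ a c *_) (δ-≢ b≢d)) (ℤₚ.*-zeroʳ (δ a c))

orientation-same : ∀ {a b : Fin n} → a ≢ b → orientation a b a b ≡ 1ℤ
orientation-same {a = a} {b} a≢b rewrite δ-refl a | δ-refl b | δ-≢ a≢b = refl

orientation-reversed : ∀ {a b : Fin n} → a ≢ b → orientation a b b a ≡ - 1ℤ
orientation-reversed {a = a} {b} a≢b rewrite δ-refl a | δ-refl b | δ-≢ a≢b = refl

orientation-sym : ∀ (a b c d : Fin n) → orientation a b c d ≡ orientation c d a b
orientation-sym a b c d rewrite δ-sym a c | δ-sym b d | δ-sym a d | δ-sym b c = swap (δ c a) (δ d b) (δ d a) (δ c b)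
  where
  swap : ∀ x y z w → x * y - z * w ≡ x * y - w * z
  swap = solve-∀

orientation-flipˡ : ∀ (a b c d : Fin n) → orientation b a c d ≡ - orientation a b c d
orientation-flipˡ a b c d = flip (δ b c) (δ a d) (δ b d) (δ a c)
  where
  flip : ∀ x y z w → x * y - z * w ≡ - (w * z - y * x)
  flip = solve-∀

helmholtzEntry-flipˡ : ∀ (G : Graph n) a b c d → helmholtzEntry G b a c d ≡ - helmholtzEntry G a b c d
helmholtzEntry-flipˡ {n} G a b c d = trans (cong (boundaryProduct b a c d +_)
    (trans (sumFin-cong n (λ w → flip-cycle (indicator (G w a)) (indicator (G w b)) (δ c a) (δ d b) (δ c b) (δ d w) (δ c w) (δ d a)))
      (sumFin-neg n (λ w → indicator (G w a) * indicator (G w b) * cycleCoefficient a b w c d))))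
  (flip-boundary (δ a c) (δ a d) (δ b c) (δ b d) (trianglePart G a b c d))
  where
  flip-boundary : ∀ ac ad bc bd t → bc - bd - ac + ad + - t ≡ - (ac - ad - bc + bd + t)
  flip-boundary = solve-∀
  flip-cycle : ∀ ga gb ca db cb dw cw da → gb * ga * (cb * da + ca * dw + cw * db - ca * db - cw * da - cb * dw)
     ≡ - (ga * gb * (ca * db + cb * dw + cw * da - cb * da - cw * db - ca * dw))
  flip-cycle = solve-∀

helmholtzEntry-flipʳ : ∀ (G : Graph n) a b c d → helmholtzEntry G a b d c ≡ - helmholtzEntry G a b c d
helmholtzEntry-flipʳ {n} G a b c d = trans (cong (boundaryProduct a b d c +_)
    (trans (sumFin-cong n (λ w → flip-cycle (indicator (G w a)) (indicator (G w b)) (δ c a) (δ d b) (δ c b) (δ d w) (δ c w) (δ d a)))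
      (sumFin-neg n (λ w → indicator (G w a) * indicator (G w b) * cycleCoefficient a b w c d))))
  (flip-boundary (δ a c) (δ a d) (δ b c) (δ b d) (trianglePart G a b c d))
  where
  flip-boundary : ∀ ac ad bc bd t → ad - ac - bd + bc + - t ≡ - (ac - ad - bc + bd + t)
  flip-boundary = solve-∀
  flip-cycle : ∀ ga gb ca db cb dw cw da → ga * gb * (da * cb + db * cw + dw * ca - db * ca - dw * cb - da * cw)
     ≡ - (ga * gb * (ca * db + cb * dw + cw * da - cb * da - cw * db - ca * dw))
  flip-cycle = solve-∀

edgeOrientation : Edge n → Edge n → ℤ
edgeOrientation e f = orientation (proj₁ e) (proj₂ e) (proj₁ f) (proj₂ f)

adj⇒≢ : ∀ {G : Graph n} → IsSimpleGraph G → ∀ {a b} → Adj G a b → a ≢ b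
adj⇒≢ {G = G} (_ , irreflexive) {a} Gab refl with () ← trans (sym Gab) (irreflexive a)

module EdgeEnumeration {G : Graph n} (simple : IsSimpleGraph G) {m ed} (E : IsEdgeEnumeration G m ed) where
  open IsEdgeEnumeration E

  edgeOrientation-δ : ∀ i j → edgeOrientation (ed j) (ed i) ≡ δ i j
  edgeOrientation-δ i j with i ≟ j
  ... | yes refl = trans (orientation-same (adj⇒≢ simple (adjacent i))) (sym (δ-refl i))
  ... | no i≢j = trans (orientation-distinct _ _ _ _ (λ same → i≢j (sym (unique j i same)))) (sym (δ-≢ i≢j))

  sum-orientation : ∀ (ψ : Edge n → ℤ) → (∀ c d → ψ (d , c) ≡ - ψ (c , d)) →
    ∀ f → Adj G (proj₁ f) (proj₂ f) → sumFin m (λ k → ψ (ed k) * edgeOrientation (ed k) f) ≡ ψ f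
  sum-orientation ψ odd f@(a , b) Gab = trans (sumFin-single m k₀ _ others) (at-k₀ (ed k₀) (proj₂ (covering a b Gab)))
    where
    k₀ : Fin m
    k₀ = proj₁ (covering a b Gab)
    others : ∀ k → k ≢ k₀ → ψ (ed k) * edgeOrientation (ed k) f ≡ 0ℤ
    others k k≢k₀ = trans (cong (ψ (ed k) *_) (orientation-distinct _ _ _ _
        (λ same → k≢k₀ (unique k k₀ (SameEdge-trans same (SameEdge-sym (proj₂ (covering a b Gab)))))))) (ℤₚ.*-zeroʳ (ψ (ed k)))
    at-k₀ : ∀ e → SameEdge e f → ψ e * edgeOrientation e f ≡ ψ f
    at-k₀ (.a , .b) (inj₁ (refl , refl)) = trans (cong (ψ (a , b) *_) (orientation-same (adj⇒≢ simple Gab))) (ℤₚ.*-identityʳ _)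
    at-k₀ (.b , .a) (inj₂ (refl , refl)) = trans (cong₂ _*_ (odd a b) (orientation-reversed (adj⇒≢ simple Gab ∘ sym)))
      (neg-neg (ψ (a , b)))
      where
      neg-neg : ∀ x → - x * - 1ℤ ≡ x
      neg-neg = solve-∀

module _ {G : Graph n} (simple : IsSimpleGraph G) where

  enumeration-size-≤ : ∀ {m₁ m₂ e₁ e₂} → IsEdgeEnumeration G m₁ e₁ → IsEdgeEnumeration G m₂ e₂ → m₁ ℕ.≤ m₂
  enumeration-size-≤ {m₁} {m₂} {e₁} {e₂} E₁ E₂ = Finₚ.injective⇒≤ {f = index} index-injective
    where
    module E₁ = IsEdgeEnumeration E₁
    module E₂ = IsEdgeEnumeration E₂
    located : ∀ k → Σ _ λ i → SameEdge (e₂ i) (e₁ k)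
    located k = E₂.covering (proj₁ (e₁ k)) (proj₂ (e₁ k)) (E₁.adjacent k)
    index : Fin m₁ → Fin m₂
    index = proj₁ ∘ located
    index-injective : ∀ {k k′} → index k ≡ index k′ → k ≡ k′
    index-injective {k} {k′} same-index = E₁.unique k k′ (SameEdge-trans (SameEdge-sym (proj₂ (located k)))
      (subst (λ i → SameEdge (e₂ i) (e₁ k′)) (sym same-index) (proj₂ (located k′))))

  -- Two enumerations differ by a signed permutation, which conjugates their Helmholtzians.
  integral-reenumerate : ∀ {m₁ m₂ e₁ e₂} → IsEdgeEnumeration G m₁ e₁ → IsEdgeEnumeration G m₂ e₂ →
    AllEigenvaluesIntegral m₂ (helmholtzianOf G e₂) → AllEigenvaluesIntegral m₁ (helmholtzianOf G e₁)
  integral-reenumerate {m₁} {m₂} {e₁} {e₂} E₁ E₂ with ℕₚ.≤-antisym (enumeration-size-≤ E₁ E₂) (enumeration-size-≤ E₂ E₁)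
  ... | refl = integral-similar m₁ (helmholtzianOf G e₁) (helmholtzianOf G e₂) P Q H₁P≗PH₂ QP≗I
    where
    open EdgeEnumeration simple
    P Q : Mat m₁ m₁
    P i j = edgeOrientation (e₁ i) (e₂ j)
    Q i j = edgeOrientation (e₁ j) (e₂ i)
    H₁P≗PH₂ : matMul (helmholtzianOf G e₁) P ≗ᴹ matMul P (helmholtzianOf G e₂)
    H₁P≗PH₂ i j = trans
      (sum-orientation E₁ (helmholtzEdge G (e₁ i)) (helmholtzEntry-flipʳ G (proj₁ (e₁ i)) (proj₂ (e₁ i))) (e₂ j) (IsEdgeEnumeration.adjacent E₂ j))
      (sym (trans (sumFin-cong m₁ (λ k → trans (ℤₚ.*-comm (P i k) _) (cong (helmholtzEdge G (e₂ k) (e₂ j) *_) (orientation-sym (proj₁ (e₁ i)) (proj₂ (e₁ i)) (proj₁ (e₂ k)) (proj₂ (e₂ k))))))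
        (sum-orientation E₂ (λ e → helmholtzEdge G e (e₂ j)) (λ c d → helmholtzEntry-flipˡ G c d (proj₁ (e₂ j)) (proj₂ (e₂ j))) (e₁ i) (IsEdgeEnumeration.adjacent E₁ i))))
    QP≗I : matMul Q P ≗ᴹ identity m₁
    QP≗I i j = trans (sum-orientation E₁ (λ e → edgeOrientation e (e₂ i)) (λ c d → orientation-flipˡ c d (proj₁ (e₂ i)) (proj₂ (e₂ i))) (e₂ j) (IsEdgeEnumeration.adjacent E₂ j))
      (edgeOrientation-δ E₂ i j)

lookup-injective : ∀ {A : Set} (xs : List A) → Unique xs → ∀ i j → lookup xs i ≡ lookup xs j → i ≡ j
lookup-injective (x ∷ xs) (_ AllPairs.∷ _) zero zero _ = refl
lookup-injective (x ∷ xs) (x∉xs AllPairs.∷ _) zero (suc j) x≡ = ⊥-elim (All.lookup x∉xs (∈-lookup j) x≡)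
lookup-injective (x ∷ xs) (x∉xs AllPairs.∷ _) (suc i) zero ≡x = ⊥-elim (All.lookup x∉xs (∈-lookup i) (sym ≡x))
lookup-injective (x ∷ xs) (_ AllPairs.∷ unique) (suc i) (suc j) e = cong suc (lookup-injective xs unique i j e)

module EdgeList (G : Graph n) (simple : IsSimpleGraph G) where
  private
    isEdge : Edge n → Bool
    isEdge (a , b) = (a <F b) ∧ G a b

    candidates : List (Edge n)
    candidates = cartesianProduct (allFin n) (allFin n)

  edge : Fin (nE G) → Edge n
  edge = lookup (edges G)

  private
    edge-isEdge : ∀ i → T (isEdge (edge i))
    edge-isEdge i = All.lookup (all-filter (T? ∘ isEdge) candidates) (∈-lookup i)

  edge-ordered : ∀ i → toℕ (proj₁ (edge i)) ℕ.< toℕ (proj₂ (edge i))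
  edge-ordered i = ℕₚ.<ᵇ⇒< _ _ (proj₁ (Equivalence.to T-∧ (edge-isEdge i)))

  edge-adjacent : ∀ i → Adj G (proj₁ (edge i)) (proj₂ (edge i))
  edge-adjacent i = Equivalence.to T-≡ (proj₂ (Equivalence.to T-∧ (edge-isEdge i)))

  edge-index : ∀ a b → toℕ a ℕ.< toℕ b → Adj G a b → Σ (Fin (nE G)) λ i → edge i ≡ (a , b)
  edge-index a b a<b Gab = Any.index ab∈edges , sym (lookup-index ab∈edges)
    where
    ab∈edges : (a , b) ∈ edges G
    ab∈edges = ∈-filter⁺ (T? ∘ isEdge) (∈-cartesianProduct⁺ (∈-allFin a) (∈-allFin b))
      (Equivalence.from T-∧ (ℕₚ.<⇒<ᵇ a<b , Equivalence.from T-≡ Gab))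

  edges-unique : Unique (edges G)
  edges-unique = Uniqueₚ.filter⁺ (T? ∘ isEdge) (Uniqueₚ.cartesianProduct⁺ (Uniqueₚ.allFin⁺ n) (Uniqueₚ.allFin⁺ n))

  edges-isEdgeEnumeration : IsEdgeEnumeration G (nE G) edge
  edges-isEdgeEnumeration = record { adjacent = edge-adjacent ; covering = covering ; unique = unique }
    where
    covering : ∀ a b → Adj G a b → Σ (Fin (nE G)) λ i → SameEdge (edge i) (a , b)
    covering a b Gab with ℕₚ.<-cmp (toℕ a) (toℕ b)
    ... | tri< a<b _ _ = let i , e = edge-index a b a<b Gab in i , inj₁ (cong proj₁ e , cong proj₂ e)
    ... | tri≈ _ a≡b _ = ⊥-elim (adj⇒≢ simple Gab (Finₚ.toℕ-injective a≡b))
    ... | tri> _ _ b<a = let i , e = edge-index b a b<a (trans (proj₁ simple b a) Gab) in i , inj₂ (cong proj₁ e , cong proj₂ e)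
    unique : ∀ i j → SameEdge (edge i) (edge j) → i ≡ j
    unique i j (inj₁ (a≡c , b≡d)) = lookup-injective (edges G) edges-unique i j (cong₂ _,_ a≡c b≡d)
    unique i j (inj₂ (a≡d , b≡c)) = ⊥-elim (ℕₚ.<-asym (subst₂ ℕ._<_ (cong toℕ a≡d) (cong toℕ b≡c) (edge-ordered i)) (edge-ordered j))

-- The Helmholtzian 𝓑𝓑ᵀ + 𝓒ᵀ𝓒 in coordinates

sumList : ∀ {A : Set} → (A → ℤ) → List A → ℤ
sumList f [] = 0ℤ
sumList f (x ∷ xs) = f x + sumList f xs

sumFin-lookup : ∀ {A : Set} (xs : List A) (f : A → ℤ) → sumFin (length xs) (f ∘ lookup xs) ≡ sumList f xs
sumFin-lookup [] f = refl
sumFin-lookup (x ∷ xs) f = cong (f x +_) (sumFin-lookup xs f)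

sumList-filterᵇ : ∀ {A : Set} (P : A → Bool) (f : A → ℤ) xs → sumList f (filterᵇ P xs) ≡ sumList (λ x → if P x then f x else 0ℤ) xs
sumList-filterᵇ P f [] = refl
sumList-filterᵇ P f (x ∷ xs) with P x
... | true = cong (f x +_) (sumList-filterᵇ P f xs)
... | false = trans (sumList-filterᵇ P f xs) (sym (ℤₚ.+-identityˡ _))

sumList-++ : ∀ {A : Set} (f : A → ℤ) xs ys → sumList f (xs List.++ ys) ≡ sumList f xs + sumList f ys
sumList-++ f [] ys = sym (ℤₚ.+-identityˡ _)
sumList-++ f (x ∷ xs) ys = trans (cong (f x +_) (sumList-++ f xs ys)) (sym (ℤₚ.+-assoc (f x) _ _))

sumList-map : ∀ {A B : Set} (f : B → ℤ) (g : A → B) xs → sumList f (map g xs) ≡ sumList (f ∘ g) xs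
sumList-map f g [] = refl
sumList-map f g (x ∷ xs) = cong (f (g x) +_) (sumList-map f g xs)

sumList-cartesianProduct : ∀ {A B : Set} (f : A × B → ℤ) xs ys →
  sumList f (cartesianProduct xs ys) ≡ sumList (λ x → sumList (λ y → f (x , y)) ys) xs
sumList-cartesianProduct f [] ys = refl
sumList-cartesianProduct f (x ∷ xs) ys =
  trans (sumList-++ f (map (x ,_) ys) _) (cong₂ _+_ (sumList-map f (x ,_) ys) (sumList-cartesianProduct f xs ys))

sumList-tabulate : ∀ {A : Set} n (g : Fin n → A) (f : A → ℤ) → sumList f (tabulate g) ≡ sumFin n (f ∘ g)
sumList-tabulate zero g f = refl
sumList-tabulate (suc n) g f = cong (f (g zero) +_) (sumList-tabulate n (g ∘ suc) f)

sumList-allFin : ∀ n (f : Fin n → ℤ) → sumList f (allFin n) ≡ sumFin n f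
sumList-allFin n f = sumList-tabulate n id f

incB-entry : ∀ (t h v : Fin n) → t ≢ h → (if v =F t then - 1ℤ else (if v =F h then 1ℤ else 0ℤ)) ≡ δ h v - δ t v
incB-entry t h v t≢h with v ≟ t
... | yes refl rewrite =F-refl v | δ-≢ (t≢h ∘ sym) = refl
... | no v≢t rewrite ≢⇒=F-false v≢t | δ-≢ (v≢t ∘ sym) with v ≟ h
...   | yes refl rewrite =F-refl v = refl
...   | no v≢h rewrite ≢⇒=F-false v≢h | δ-≢ (v≢h ∘ sym) = refl

boundary-sum : ∀ (a b c d : Fin n) → sumFin n (λ v → (δ b v - δ a v) * (δ d v - δ c v)) ≡ boundaryProduct a b c d
boundary-sum {n} a b c d = begin
  sumFin n (λ v → (δ b v - δ a v) * (δ d v - δ c v))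
    ≡⟨ sumFin-cong n (λ v → distrib (δ b v) (δ a v) (δ d v - δ c v)) ⟩
  sumFin n (λ v → δ b v * (δ d v - δ c v) + - (δ a v * (δ d v - δ c v)))
    ≡⟨ sumFin-+ n (λ v → δ b v * (δ d v - δ c v)) (λ v → - (δ a v * (δ d v - δ c v))) ⟩
  sumFin n (λ v → δ b v * (δ d v - δ c v)) + sumFin n (λ v → - (δ a v * (δ d v - δ c v)))
    ≡⟨ cong₂ _+_ (sumFin-δˡ n b (λ v → δ d v - δ c v)) (trans (sumFin-neg n (λ v → δ a v * (δ d v - δ c v))) (cong -_ (sumFin-δˡ n a (λ v → δ d v - δ c v)))) ⟩
  (δ d b - δ c b) + - (δ d a - δ c a)
    ≡⟨ cong₂ (λ x y → x + - y) (cong₂ _-_ (δ-sym d b) (δ-sym c b)) (cong₂ _-_ (δ-sym d a) (δ-sym c a)) ⟩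
  (δ b d - δ b c) + - (δ a d - δ a c)
    ≡⟨ rearrange (δ a c) (δ a d) (δ b c) (δ b d) ⟩
  boundaryProduct a b c d ∎
  where
  open ≡-Reasoning
  distrib : ∀ x y z → (x - y) * z ≡ x * z + - (y * z)
  distrib = solve-∀
  rearrange : ∀ ac ad bc bd → (bd - bc) + - (ad - ac) ≡ ac - ad - bc + bd
  rearrange = solve-∀

<F⇒< : ∀ {i j : Fin n} → (i <F j) ≡ true → toℕ i ℕ.< toℕ j
<F⇒< {i = i} {j} e = ℕₚ.<ᵇ⇒< (toℕ i) (toℕ j) (Equivalence.from T-≡ e)

<⇒<F : ∀ {i j : Fin n} → toℕ i ℕ.< toℕ j → (i <F j) ≡ true
<⇒<F i<j = Equivalence.to T-≡ (ℕₚ.<⇒<ᵇ i<j)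

≥⇒<F-false : ∀ {i j : Fin n} → toℕ j ℕ.≤ toℕ i → (i <F j) ≡ false
≥⇒<F-false {i = i} {j} j≤i with i <F j in e
... | true = ⊥-elim (ℕₚ.<⇒≱ (<F⇒< e) j≤i)
... | false = refl

isTriangle : Graph n → Fin n → Fin n → Fin n → Bool
isTriangle G p q r = (p <F q) ∧ (q <F r) ∧ G p q ∧ G q r ∧ G p r

triangleCoefficient : (p q r a b : Fin n) → ℤ
triangleCoefficient p q r a b =
  if (a =F p) ∧ (b =F q) then 1ℤ else if (a =F q) ∧ (b =F r) then 1ℤ else if (a =F p) ∧ (b =F r) then - 1ℤ else 0ℤ

triangleSum : Graph n → (Fin n → Fin n → Fin n → ℤ) → ℤ
triangleSum {n} G F = sumFin n λ p → sumFin n λ q → sumFin n λ r → if isTriangle G p q r then F p q r else 0ℤ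

incC-product : ∀ (G : Graph n) i j → let (a , b) = lookup (edges G) i ; (c , d) = lookup (edges G) j in
  matMul (transpose (incC G)) (incC G) i j ≡ triangleSum G (λ p q r → triangleCoefficient p q r a b * triangleCoefficient p q r c d)
incC-product {n} G i j = begin
  sumFin (nT G) (Φ ∘ lookup (triangles G))
    ≡⟨ sumFin-lookup (triangles G) Φ ⟩
  sumList Φ (triangles G)
    ≡⟨ sumList-filterᵇ isTriangle′ Φ (cartesianProduct (allFin n) (cartesianProduct (allFin n) (allFin n))) ⟩
  sumList Φ′ (cartesianProduct (allFin n) (cartesianProduct (allFin n) (allFin n)))
    ≡⟨ sumList-cartesianProduct Φ′ (allFin n) _ ⟩
  sumList (λ p → sumList (λ qr → Φ′ (p , qr)) (cartesianProduct (allFin n) (allFin n))) (allFin n)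
    ≡⟨ sumList-allFin n _ ⟩
  sumFin n (λ p → sumList (λ qr → Φ′ (p , qr)) (cartesianProduct (allFin n) (allFin n)))
    ≡⟨ sumFin-cong n (λ p → trans (sumList-cartesianProduct (λ qr → Φ′ (p , qr)) (allFin n) (allFin n))
         (trans (sumList-allFin n _) (sumFin-cong n (λ q → sumList-allFin n (λ r → Φ′ (p , q , r)))))) ⟩
  triangleSum G (λ p q r → triangleCoefficient p q r a b * triangleCoefficient p q r c d) ∎
  where
  open ≡-Reasoning
  a b c d : Fin n
  a = proj₁ (lookup (edges G) i)
  b = proj₂ (lookup (edges G) i)
  c = proj₁ (lookup (edges G) j)
  d = proj₂ (lookup (edges G) j)
  isTriangle′ : Fin n × Fin n × Fin n → Bool
  isTriangle′ (p , q , r) = isTriangle G p q r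
  Φ : Fin n × Fin n × Fin n → ℤ
  Φ (p , q , r) = triangleCoefficient p q r a b * triangleCoefficient p q r c d
  Φ′ : Fin n × Fin n × Fin n → ℤ
  Φ′ t = if isTriangle′ t then Φ t else 0ℤ

private
  ⟦_⟧ : Bool → ℤ
  ⟦ b ⟧ = if b then 1ℤ else 0ℤ

  coefficient-boolean : ∀ cp dq cq dr → (cp ≡ true → cq ≡ false) → (dq ≡ true → dr ≡ false) →
    (if cp ∧ dq then 1ℤ else if cq ∧ dr then 1ℤ else if cp ∧ dr then - 1ℤ else 0ℤ) ≡ ⟦ cp ⟧ * ⟦ dq ⟧ + ⟦ cq ⟧ * ⟦ dr ⟧ - ⟦ cp ⟧ * ⟦ dr ⟧
  coefficient-boolean true _ true _ ¬cq _ with () ← ¬cq refl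
  coefficient-boolean _ true _ true _ ¬dr with () ← ¬dr refl
  coefficient-boolean true true false false _ _ = refl
  coefficient-boolean true false false true _ _ = refl
  coefficient-boolean true false false false _ _ = refl
  coefficient-boolean false true true false _ _ = refl
  coefficient-boolean false true false false _ _ = refl
  coefficient-boolean false false true true _ _ = refl
  coefficient-boolean false false true false _ _ = refl
  coefficient-boolean false false false true _ _ = refl
  coefficient-boolean false false false false _ _ = refl

triangleCoefficient-ordered : ∀ (p q r c d : Fin n) → toℕ p ℕ.< toℕ q → toℕ q ℕ.< toℕ r →
  triangleCoefficient p q r c d ≡ δ c p * δ d q + δ c q * δ d r - δ c p * δ d r
triangleCoefficient-ordered p q r c d p<q q<r = coefficient-boolean (c =F p) (d =F q) (c =F q) (d =F r)
  (λ c≡p → ≢⇒=F-false {i = c} {j = q} (λ c≡q → ℕₚ.<-irrefl (cong toℕ (trans (sym (=F⇒≡ {i = c} {j = p} c≡p)) c≡q)) p<q))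
  (λ d≡q → ≢⇒=F-false {i = d} {j = r} (λ d≡r → ℕₚ.<-irrefl (cong toℕ (trans (sym (=F⇒≡ {i = d} {j = q} d≡q)) d≡r)) q<r))

δ-product-reversed : ∀ {c d x y : Fin n} → toℕ c ℕ.< toℕ d → toℕ y ℕ.< toℕ x → δ c x * δ d y ≡ 0ℤ
δ-product-reversed {c = c} {d} {x} {y} c<d y<x with c ≟ x | d ≟ y
... | yes refl | yes refl = ⊥-elim (ℕₚ.<-asym c<d y<x)
... | no c≢x | _ rewrite δ-≢ c≢x = refl
... | yes refl | no d≢y rewrite δ-≢ d≢y = ℤₚ.*-zeroʳ (δ c c)

δδ-collapse : ∀ (a b : Fin n) (g : Fin n → Fin n → ℤ) → sumFin n (λ x → sumFin n (λ y → δ a x * δ b y * g x y)) ≡ g a b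
δδ-collapse {n} a b g = trans (sumFin-cong n (λ x → trans (sumFin-cong n (λ y → ℤₚ.*-assoc (δ a x) (δ b y) (g x y)))
    (trans (sumFin-*ˡ n (δ a x) (λ y → δ b y * g x y)) (cong (δ a x *_) (sumFin-δˡ n b (g x))))))
  (sumFin-δˡ n a (λ x → g x b))

-- For sorted edges a → b and c → d, the triangles through a → b are those on
-- a third vertex w, and their contribution is the coefficient of c → d in
-- the cycle a → b → w → a.
module TriangleCollapse (G : Graph n) (simple : IsSimpleGraph G) (a b c d : Fin n)
                        (a<b : toℕ a ℕ.< toℕ b) (c<d : toℕ c ℕ.< toℕ d) (Gab : Adj G a b) where
  private
    symmetric : ∀ x y → G x y ≡ G y x
    symmetric = proj₁ simple
    irreflexive : ∀ x → G x x ≡ false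
    irreflexive = proj₂ simple

  Y : Fin n → Fin n → Fin n → ℤ
  Y p q r = if isTriangle G p q r then triangleCoefficient p q r c d else 0ℤ

  private
    integrand-factors : ∀ p q r → (if isTriangle G p q r then triangleCoefficient p q r a b * triangleCoefficient p q r c d else 0ℤ)
                                  ≡ (δ a p * δ b q + δ a q * δ b r - δ a p * δ b r) * Y p q r
    integrand-factors p q r with isTriangle G p q r in e
    ... | false = sym (ℤₚ.*-zeroʳ (δ a p * δ b q + δ a q * δ b r - δ a p * δ b r))
    ... | true = cong (_* triangleCoefficient p q r c d) (triangleCoefficient-ordered p q r a b p<q q<r)
      where
      p<q : toℕ p ℕ.< toℕ q
      p<q = <F⇒< {i = p} {j = q} (Boolₚ.∧-conicalˡ _ _ e)
      q<r : toℕ q ℕ.< toℕ r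
      q<r = <F⇒< {i = q} {j = r} (Boolₚ.∧-conicalˡ _ _ (Boolₚ.∧-conicalʳ (p <F q) _ e))

    <F-true : ∀ (i j : Fin n) → toℕ i ℕ.< toℕ j → (i <F j) ≡ true
    <F-true i j i<j = <⇒<F {i = i} {j = j} i<j
    <F-false : ∀ (i j : Fin n) → toℕ j ℕ.≤ toℕ i → (i <F j) ≡ false
    <F-false i j j≤i = ≥⇒<F-false {i = i} {j = j} j≤i
    reversed : ∀ x y → toℕ y ℕ.< toℕ x → δ c x * δ d y ≡ 0ℤ
    reversed x y = δ-product-reversed {c = c} {d} {x} {y} c<d

    Contribution : Fin n → Set
    Contribution w = Y a b w + Y w a b - Y a w b ≡ indicator (G w a) * indicator (G w b) * cycleCoefficient a b w c d

    w-before-a : ∀ w → toℕ w ℕ.< toℕ a → Contribution w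
    w-before-a w w<a rewrite <F-true a b a<b | <F-false b w (ℕₚ.<⇒≤ (ℕₚ.<-trans w<a a<b)) | <F-false a w (ℕₚ.<⇒≤ w<a)
                           | <F-true w a w<a | Gab with G w a | G w b
    ... | false | _ = refl
    ... | true | false = refl
    ... | true | true rewrite triangleCoefficient-ordered w a b c d w<a a<b | reversed b w (ℕₚ.<-trans w<a a<b)
                            | reversed b a a<b | reversed a w w<a = simplify (δ c w * δ d a) (δ c a * δ d b) (δ c w * δ d b)
      where
      simplify : ∀ x y z → 0ℤ + (x + y - z) - 0ℤ ≡ 1ℤ * 1ℤ * (y + 0ℤ + x - 0ℤ - z - 0ℤ)
      simplify = solve-∀

    w-is-a : Contribution a
    w-is-a rewrite <F-true a b a<b | <F-false b a (ℕₚ.<⇒≤ a<b) | <F-false a a ℕₚ.≤-refl | irreflexive a = refl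

    w-between : ∀ w → toℕ a ℕ.< toℕ w → toℕ w ℕ.< toℕ b → Contribution w
    w-between w a<w w<b rewrite <F-true a b a<b | <F-false b w (ℕₚ.<⇒≤ w<b) | <F-false w a (ℕₚ.<⇒≤ a<w) | <F-true a w a<w
                              | <F-true w b w<b | Gab | symmetric a w with G w a | G w b
    ... | false | _ = refl
    ... | true | false = refl
    ... | true | true rewrite triangleCoefficient-ordered a w b c d a<w w<b | reversed b w w<b | reversed w a a<w
                            | reversed b a a<b = simplify (δ c a * δ d w) (δ c w * δ d b) (δ c a * δ d b)
      where
      simplify : ∀ x y z → 0ℤ + 0ℤ - (x + y - z) ≡ 1ℤ * 1ℤ * (z + 0ℤ + 0ℤ - 0ℤ - y - x)
      simplify = solve-∀

    w-is-b : Contribution b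
    w-is-b rewrite <F-true a b a<b | <F-false b b ℕₚ.≤-refl | <F-false b a (ℕₚ.<⇒≤ a<b) | irreflexive b | symmetric b a | Gab = refl

    w-after-b : ∀ w → toℕ b ℕ.< toℕ w → Contribution w
    w-after-b w b<w rewrite <F-true a b a<b | <F-true b w b<w | <F-false w a (ℕₚ.<⇒≤ (ℕₚ.<-trans a<b b<w))
                          | <F-true a w (ℕₚ.<-trans a<b b<w) | <F-false w b (ℕₚ.<⇒≤ b<w) | Gab
                          | symmetric a w | symmetric b w with G w a | G w b
    ... | false | false = refl
    ... | false | true = refl
    ... | true | false = refl
    ... | true | true rewrite triangleCoefficient-ordered a b w c d a<b b<w | reversed w a (ℕₚ.<-trans a<b b<w) | reversed b a a<b
                            | reversed w b b<w = simplify (δ c a * δ d b) (δ c b * δ d w) (δ c a * δ d w)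
      where
      simplify : ∀ x y z → x + y - z + 0ℤ - 0ℤ ≡ 1ℤ * 1ℤ * (x + y + 0ℤ - 0ℤ - 0ℤ - z)
      simplify = solve-∀

    contribution : ∀ w → Contribution w
    contribution w with ℕₚ.<-cmp (toℕ w) (toℕ a)
    ... | tri< w<a _ _ = w-before-a w w<a
    ... | tri≈ _ w≡a _ rewrite Finₚ.toℕ-injective w≡a = w-is-a
    ... | tri> _ _ a<w with ℕₚ.<-cmp (toℕ w) (toℕ b)
    ...   | tri< w<b _ _ = w-between w a<w w<b
    ...   | tri≈ _ w≡b _ rewrite Finₚ.toℕ-injective w≡b = w-is-b
    ...   | tri> _ _ b<w = w-after-b w b<w

    sum³ : (Fin n → Fin n → Fin n → ℤ) → ℤ
    sum³ F = sumFin n λ p → sumFin n λ q → sumFin n λ r → F p q r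

    sumFin-+- : ∀ (f g h : Fin n → ℤ) → sumFin n (λ i → f i + g i - h i) ≡ sumFin n f + sumFin n g - sumFin n h
    sumFin-+- f g h = trans (sumFin-+ n (λ i → f i + g i) (λ i → - h i))
      (cong₂ _+_ (sumFin-+ n f g) (sumFin-neg n h))

    sum³-+- : ∀ (F H K : Fin n → Fin n → Fin n → ℤ) → sum³ (λ p q r → F p q r + H p q r - K p q r) ≡ sum³ F + sum³ H - sum³ K
    sum³-+- F H K = trans (sumFin-cong n (λ p → trans (sumFin-cong n (λ q → sumFin-+- (F p q) (H p q) (K p q)))
      (sumFin-+- (λ q → sumFin n (F p q)) (λ q → sumFin n (H p q)) (λ q → sumFin n (K p q)))))
      (sumFin-+- (λ p → sumFin n (λ q → sumFin n (F p q))) (λ p → sumFin n (λ q → sumFin n (H p q))) (λ p → sumFin n (λ q → sumFin n (K p q))))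

    collapse-ab· : sum³ (λ p q r → δ a p * δ b q * Y p q r) ≡ sumFin n (Y a b)
    collapse-ab· = trans (sumFin-cong n (λ p → sumFin-cong n (λ q → sumFin-*ˡ n (δ a p * δ b q) (Y p q))))
      (δδ-collapse a b (λ p q → sumFin n (Y p q)))

    collapse-·ab : sum³ (λ p q r → δ a q * δ b r * Y p q r) ≡ sumFin n (λ p → Y p a b)
    collapse-·ab = sumFin-cong n (λ p → δδ-collapse a b (Y p))

    collapse-a·b : sum³ (λ p q r → δ a p * δ b r * Y p q r) ≡ sumFin n (λ q → Y a q b)
    collapse-a·b = trans (sumFin-cong n (λ p → trans (sumFin-comm n n (λ q r → δ a p * δ b r * Y p q r))
        (sumFin-cong n (λ r → sumFin-*ˡ n (δ a p * δ b r) (λ q → Y p q r)))))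
      (δδ-collapse a b (λ p r → sumFin n (λ q → Y p q r)))

  triangleSum≡trianglePart : triangleSum G (λ p q r → triangleCoefficient p q r a b * triangleCoefficient p q r c d) ≡ trianglePart G a b c d
  triangleSum≡trianglePart = begin
    triangleSum G (λ p q r → triangleCoefficient p q r a b * triangleCoefficient p q r c d)
      ≡⟨ sumFin-cong n (λ p → sumFin-cong n (λ q → sumFin-cong n (λ r → trans (integrand-factors p q r)
           (distrib (δ a p * δ b q) (δ a q * δ b r) (δ a p * δ b r) (Y p q r))))) ⟩
    sum³ (λ p q r → δ a p * δ b q * Y p q r + δ a q * δ b r * Y p q r - δ a p * δ b r * Y p q r)
      ≡⟨ sum³-+- (λ p q r → δ a p * δ b q * Y p q r) (λ p q r → δ a q * δ b r * Y p q r) (λ p q r → δ a p * δ b r * Y p q r) ⟩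
    sum³ (λ p q r → δ a p * δ b q * Y p q r) + sum³ (λ p q r → δ a q * δ b r * Y p q r) - sum³ (λ p q r → δ a p * δ b r * Y p q r)
      ≡⟨ cong₂ _-_ (cong₂ _+_ collapse-ab· collapse-·ab) collapse-a·b ⟩
    sumFin n (Y a b) + sumFin n (λ w → Y w a b) - sumFin n (λ w → Y a w b)
      ≡⟨ sumFin-+- (Y a b) (λ w → Y w a b) (λ w → Y a w b) ⟨
    sumFin n (λ w → Y a b w + Y w a b - Y a w b)
      ≡⟨ sumFin-cong n contribution ⟩
    trianglePart G a b c d ∎
    where
    open ≡-Reasoning
    distrib : ∀ x y z w → (x + y - z) * w ≡ x * w + y * w - z * w
    distrib = solve-∀

helmholtzian-coordinates : ∀ (G : Graph n) (simple : IsSimpleGraph G) → helmholtzian G ≗ᴹ helmholtzianOf G (EdgeList.edge G simple)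
helmholtzian-coordinates {n} G simple i j = cong₂ _+_ boundary-part triangle-part
  where
  open EdgeList G simple
  a b c d : Fin n
  a = proj₁ (edge i)
  b = proj₂ (edge i)
  c = proj₁ (edge j)
  d = proj₂ (edge j)
  ordered⇒≢ : ∀ k → proj₁ (edge k) ≢ proj₂ (edge k)
  ordered⇒≢ k e = ℕₚ.<-irrefl (cong toℕ e) (edge-ordered k)
  boundary-part : matMul (incB G) (transpose (incB G)) i j ≡ boundaryProduct a b c d
  boundary-part = trans (sumFin-cong n (λ v → cong₂ _*_ (incB-entry a b v (ordered⇒≢ i)) (incB-entry c d v (ordered⇒≢ j))))
    (boundary-sum a b c d)
  triangle-part : matMul (transpose (incC G)) (incC G) i j ≡ trianglePart G a b c d
  triangle-part = trans (incC-product G i j)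
    (TriangleCollapse.triangleSum≡trianglePart G simple a b c d (edge-ordered i) (edge-ordered j) (edge-adjacent i))

-- Threshold graphs

Dominating : Graph n → Fin n → Set
Dominating G v = ∀ x → x ≢ v → Adj G v x

Isolated : Graph n → Fin n → Set
Isolated G v = ∀ x → NonAdj G v x

degree : Graph n → Fin n → ℤ
degree {n} G x = sumFin n (λ z → indicator (G x z))

indicator-mono : ∀ {a b} → (a ≡ true → b ≡ true) → indicator a ≤ indicator b
indicator-mono {false} {false} _ = ℤₚ.≤-refl
indicator-mono {false} {true} _ = +≤+ ℕ.z≤n
indicator-mono {true} a⇒b rewrite a⇒b refl = ℤₚ.≤-refl

module Threshold {G : Graph n} (simple : IsSimpleGraph G) (threshold : IsThreshold G) where
  private
    symmetric : ∀ x y → G x y ≡ G y x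
    symmetric = proj₁ simple
    irreflexive : ∀ x → G x x ≡ false
    irreflexive = proj₂ simple

    adj-nonAdj⇒≢ : ∀ {a b c} → Adj G a b → NonAdj G a c → b ≢ c
    adj-nonAdj⇒≢ Gab Gac refl with () ← trans (sym Gab) Gac

  -- Depending on vx and yw, the four vertices induce 2K₂, P₄ or C₄.
  noAlternatingCycle : ∀ {v y x w} → Adj G v y → NonAdj G y x → Adj G x w → NonAdj G w v → y ≢ x → w ≢ v → ⊥
  noAlternatingCycle {v} {y} {x} {w} Gvy Gyx Gxw Gwv y≢x w≢v = by-cases (G v x) refl (G y w) refl
    where
    sym-true : ∀ {a b} → Adj G a b → Adj G b a
    sym-true {a} {b} = trans (symmetric b a)
    Gvw : NonAdj G v w
    Gvw = trans (symmetric v w) Gwv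
    Gxy : NonAdj G x y
    Gxy = trans (symmetric x y) Gyx
    v≢y : v ≢ y
    v≢y = adj⇒≢ simple Gvy
    x≢w : x ≢ w
    x≢w = adj⇒≢ simple Gxw
    v≢x : v ≢ x
    v≢x refl with () ← trans (sym Gvy) Gxy
    y≢w : y ≢ w
    y≢w = adj-nonAdj⇒≢ Gvy Gvw
    distinct : Distinct4 v y x w
    distinct = v≢y , v≢x , w≢v ∘ sym , y≢x , y≢w , x≢w
    by-cases : ∀ b → G v x ≡ b → ∀ c → G y w ≡ c → ⊥
    by-cases false Gvx false Gyw = proj₁ (threshold v y x w distinct) (Gvy , Gxw , Gvx , Gvw , Gyx , Gyw)
    by-cases true Gvx false Gyw = proj₁ (proj₂ (threshold y v x w (v≢y ∘ sym , y≢x , y≢w , v≢x , w≢v ∘ sym , x≢w)))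
      (sym-true Gvy , Gvx , Gxw , Gyx , Gyw , Gvw)
    by-cases false Gvx true Gyw = proj₁ (proj₂ (threshold v y w x (v≢y , w≢v ∘ sym , v≢x , y≢w , y≢x , x≢w ∘ sym)))
      (Gvy , Gyw , sym-true Gxw , Gvw , Gvx , Gyx)
    by-cases true Gvx true Gyw = proj₂ (proj₂ (threshold y v x w (v≢y ∘ sym , y≢x , y≢w , v≢x , w≢v ∘ sym , x≢w)))
      (sym-true Gvy , Gvx , Gxw , sym-true Gyw , Gyx , Gvw)

  -- Counting N(v) ∪ {w} against N(x), with v counted on both sides when v ~ x.
  degree-strictly-larger : ∀ {v x w} → (∀ z → Adj G v z → z ≢ x → Adj G x z) → Adj G x w → NonAdj G w v → w ≢ v →
    degree G x ≤ degree G v → ⊥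
  degree-strictly-larger {v} {x} {w} N[v]⊆N[x] Gxw Gwv w≢v dx≤dv = ℤₚ.<-irrefl refl (ℤₚ.suc[i]≤j⇒i<j (begin
    1ℤ + (degree G v + c)                                        ≡⟨ reorder (degree G v) c ⟩
    degree G v + 1ℤ + c                                          ≡⟨ cong₂ (λ s t → degree G v + s + t) (sumFin-δˡ n w (λ _ → 1ℤ)) (sumFin-δˡ n v (λ _ → c)) ⟨
    degree G v + sumFin n (λ z → δ w z * 1ℤ) + sumFin n (λ z → δ v z * c)
      ≡⟨ cong (_+ sumFin n (λ z → δ v z * c)) (sumFin-+ n (λ z → indicator (G v z)) (λ z → δ w z * 1ℤ)) ⟨
    sumFin n (λ z → indicator (G v z) + δ w z * 1ℤ) + sumFin n (λ z → δ v z * c)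
      ≡⟨ sumFin-+ n (λ z → indicator (G v z) + δ w z * 1ℤ) (λ z → δ v z * c) ⟨
    sumFin n (λ z → indicator (G v z) + δ w z * 1ℤ + δ v z * c) ≤⟨ sumFin-mono-≤ n pointwise ⟩
    sumFin n (λ z → indicator (G x z) + δ x z * c)               ≡⟨ sumFin-+ n (λ z → indicator (G x z)) (λ z → δ x z * c) ⟩
    degree G x + sumFin n (λ z → δ x z * c)                      ≡⟨ cong (degree G x +_) (sumFin-δˡ n x (λ _ → c)) ⟩
    degree G x + c                                               ≤⟨ ℤₚ.+-monoˡ-≤ c dx≤dv ⟩
    degree G v + c                                               ∎))
    where
    open ℤₚ.≤-Reasoning
    c : ℤ
    c = indicator (G v x)
    reorder : ∀ d c → 1ℤ + (d + c) ≡ d + 1ℤ + c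
    reorder = solve-∀
    Gvw : NonAdj G v w
    Gvw = trans (symmetric v w) Gwv
    x≢w : x ≢ w
    x≢w = adj⇒≢ simple Gxw
    v≢x : v ≢ x
    v≢x refl with () ← trans (sym Gxw) (trans (symmetric x w) Gwv)
    pointwise : ∀ z → indicator (G v z) + δ w z * 1ℤ + δ v z * c ≤ indicator (G x z) + δ x z * c
    pointwise z with z ≟ x
    ... | yes refl rewrite δ-≢ (x≢w ∘ sym) | δ-≢ v≢x | δ-refl z | irreflexive z =
      ℤₚ.≤-reflexive (at-x (indicator (G v z)))
      where
      at-x : ∀ c → c + 0ℤ * 1ℤ + 0ℤ * c ≡ 0ℤ + 1ℤ * c
      at-x = solve-∀
    ... | no z≢x with z ≟ v
    ...   | yes refl rewrite δ-≢ w≢v | δ-≢ (z≢x ∘ sym) | δ-refl z | irreflexive z | symmetric x z =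
      ℤₚ.≤-reflexive (at-v (indicator (G z x)))
      where
      at-v : ∀ c → 0ℤ + 0ℤ * 1ℤ + 1ℤ * c ≡ c + 0ℤ * c
      at-v = solve-∀
    ...   | no z≢v with z ≟ w
    ...     | yes refl rewrite δ-≢ (z≢x ∘ sym) | δ-≢ (z≢v ∘ sym) | δ-refl z | Gvw | symmetric x z | Gxw = ℤₚ.≤-refl
    ...     | no z≢w rewrite δ-≢ (z≢x ∘ sym) | δ-≢ (z≢v ∘ sym) | δ-≢ (z≢w ∘ sym) =
      ℤₚ.≤-trans (ℤₚ.≤-reflexive (drop₂ (indicator (G v z)) c))
        (ℤₚ.≤-trans (indicator-mono (λ Gvz → N[v]⊆N[x] z Gvz z≢x)) (ℤₚ.≤-reflexive (sym (drop₁ (indicator (G x z)) c))))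
      where
      drop₂ : ∀ a c → a + 0ℤ * 1ℤ + 0ℤ * c ≡ a
      drop₂ = solve-∀
      drop₁ : ∀ a c → a + 0ℤ * c ≡ a
      drop₁ = solve-∀

  maxDegree-nonNeighbour-isolated : ∀ {v w} → (∀ x → degree G x ≤ degree G v) → NonAdj G v w → w ≢ v → Isolated G w
  maxDegree-nonNeighbour-isolated {v} {w} maximal Gvw w≢v x = Boolₚ.¬-not Gwx≢true
    where
    Gwv : NonAdj G w v
    Gwv = trans (symmetric w v) Gvw
    Gwx≢true : ¬ Adj G w x
    Gwx≢true Gwx with Finₚ.any? (λ y → (G v y Boolₚ.≟ true) ×-dec ¬? (y ≟ x) ×-dec (G x y Boolₚ.≟ false))
    ... | yes (y , Gvy , y≢x , Gxy) = noAlternatingCycle Gvy (trans (symmetric y x) Gxy) (trans (symmetric x w) Gwx) Gwv y≢x w≢v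
    ... | no ∄y = degree-strictly-larger N[v]⊆N[x] (trans (symmetric x w) Gwx) Gwv w≢v (maximal x)
      where
      N[v]⊆N[x] : ∀ z → Adj G v z → z ≢ x → Adj G x z
      N[v]⊆N[x] z Gvz z≢x = Boolₚ.¬-not (λ Gxz → ∄y (z , Gvz , z≢x , Gxz))

dominating-or-isolated : (G : Graph (suc n)) → IsSimpleGraph G → IsThreshold G →
  Σ (Fin (suc n)) λ v → Dominating G v ⊎ Isolated G v
dominating-or-isolated {n} G simple threshold =
  from-maximum (argmax (degree G) zero (allFin (suc n))) (λ x → All.lookup (f[xs]≤f[argmax] {f = degree G} zero (allFin (suc n))) (∈-allFin x))
  where
  from-maximum : ∀ v → (∀ x → degree G x ≤ degree G v) → Σ (Fin (suc n)) λ v → Dominating G v ⊎ Isolated G v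
  from-maximum v maximal with Finₚ.any? (λ w → ¬? (w ≟ v) ×-dec (G v w Boolₚ.≟ false))
  ... | yes (w , w≢v , Gvw) = w , inj₂ (Threshold.maxDegree-nonNeighbour-isolated simple threshold maximal Gvw w≢v)
  ... | no ∄w = v , inj₁ (λ x x≢v → Boolₚ.¬-not (λ Gvx → ∄w (x , x≢v , Gvx)))

-- Deleting a vertex

laplacian : Graph n → Mat n n
laplacian G i j = degree G i * δ i j - indicator (G i j)

onesPlusLaplacian : Graph n → Mat n n
onesPlusLaplacian G i j = 1ℤ + laplacian G i j

laplacian-rowSum : ∀ (G : Graph n) x → sumFin n (laplacian G x) ≡ 0ℤ
laplacian-rowSum {n} G x = begin
  sumFin n (λ j → degree G x * δ x j - indicator (G x j))
    ≡⟨ sumFin-+ n (λ j → degree G x * δ x j) (λ j → - indicator (G x j)) ⟩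
  sumFin n (λ j → degree G x * δ x j) + sumFin n (λ j → - indicator (G x j))
    ≡⟨ cong₂ _+_ (trans (sumFin-*ˡ n (degree G x) (δ x)) (cong (degree G x *_) (sumFin-δ x))) (sumFin-neg n (λ j → indicator (G x j))) ⟩
  degree G x * 1ℤ - degree G x
    ≡⟨ cong (_- degree G x) (ℤₚ.*-identityʳ (degree G x)) ⟩
  degree G x - degree G x
    ≡⟨ ℤₚ.+-inverseʳ (degree G x) ⟩
  0ℤ ∎
  where
  open ≡-Reasoning
  sumFin-δ : ∀ x → sumFin n (δ x) ≡ 1ℤ
  sumFin-δ x = trans (sumFin-cong n (λ j → sym (ℤₚ.*-identityʳ (δ x j)))) (sumFin-δˡ n x (λ _ → 1ℤ))

onesPlusLaplacian-rowSum : ∀ (G : Graph n) x → sumFin n (onesPlusLaplacian G x) ≡ sumFin n (λ _ → 1ℤ)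
onesPlusLaplacian-rowSum {n} G x = trans (sumFin-+ n (λ _ → 1ℤ) (laplacian G x))
  (trans (cong (sumFin n (λ _ → 1ℤ) +_) (laplacian-rowSum G x)) (ℤₚ.+-identityʳ _))

deleteVertex : Graph (suc n) → Fin (suc n) → Graph n
deleteVertex G v a b = G (punchIn v a) (punchIn v b)

deleteVertex-simple : ∀ (G : Graph (suc n)) v → IsSimpleGraph G → IsSimpleGraph (deleteVertex G v)
deleteVertex-simple G v (symmetric , irreflexive) = (λ a b → symmetric (punchIn v a) (punchIn v b)) , irreflexive ∘ punchIn v

deleteVertex-threshold : ∀ (G : Graph (suc n)) v → IsThreshold G → IsThreshold (deleteVertex G v)
deleteVertex-threshold G v threshold a b c d (a≢b , a≢c , a≢d , b≢c , b≢d , c≢d) =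
  threshold (punchIn v a) (punchIn v b) (punchIn v c) (punchIn v d) (lift a≢b , lift a≢c , lift a≢d , lift b≢c , lift b≢d , lift c≢d)
  where
  lift : ∀ {x y} → x ≢ y → punchIn v x ≢ punchIn v y
  lift x≢y = x≢y ∘ Finₚ.punchIn-injective v _ _

module VertexDeletion {n} (G : Graph (suc n)) (simple : IsSimpleGraph G) (v : Fin (suc n)) where
  private
    symmetric : ∀ x y → G x y ≡ G y x
    symmetric = proj₁ simple
    irreflexive : ∀ x → G x x ≡ false
    irreflexive = proj₂ simple

    p : Fin n → Fin (suc n)
    p = punchIn v

    δ-punchIn : ∀ a b → δ (p a) (p b) ≡ δ a b
    δ-punchIn = δ-injective (Finₚ.punchIn-injective v _ _)

    δ-punchIn-v : ∀ a → δ (p a) v ≡ 0ℤ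
    δ-punchIn-v a = δ-≢ (Finₚ.punchInᵢ≢i v a)

    δ-v-punchIn : ∀ a → δ v (p a) ≡ 0ℤ
    δ-v-punchIn a = δ-≢ (Finₚ.punchInᵢ≢i v a ∘ sym)

  G′ : Graph n
  G′ = deleteVertex G v

  degree-punchIn : ∀ k → degree G (p k) ≡ indicator (G (p k) v) + degree G′ k
  degree-punchIn k = sumFin-punchIn n v (λ z → indicator (G (p k) z))

  helmholtzEntry-punchIn : ∀ a b c d →
    helmholtzEntry G (p a) (p b) (p c) (p d) ≡ helmholtzEntry G′ a b c d + indicator (G v (p a)) * indicator (G v (p b)) * orientation c d a b
  helmholtzEntry-punchIn a b c d = begin
    boundaryProduct (p a) (p b) (p c) (p d) + trianglePart G (p a) (p b) (p c) (p d)
      ≡⟨ cong₂ _+_ boundary-punchIn (sumFin-punchIn n v (λ w → indicator (G w (p a)) * indicator (G w (p b)) * cycleCoefficient (p a) (p b) w (p c) (p d))) ⟩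
    boundaryProduct a b c d + (t * cycleCoefficient (p a) (p b) v (p c) (p d) + sumFin n (λ w → indicator (G′ w a) * indicator (G′ w b) * cycleCoefficient (p a) (p b) (p w) (p c) (p d)))
      ≡⟨ cong₂ (λ γ s → boundaryProduct a b c d + (t * γ + s)) cycle-through-v (sumFin-cong n (λ w → cong (indicator (G′ w a) * indicator (G′ w b) *_) (cycle-punchIn w))) ⟩
    boundaryProduct a b c d + (t * orientation c d a b + trianglePart G′ a b c d)
      ≡⟨ reorder (boundaryProduct a b c d) (t * orientation c d a b) (trianglePart G′ a b c d) ⟩
    helmholtzEntry G′ a b c d + t * orientation c d a b ∎
    where
    open ≡-Reasoning
    t : ℤ
    t = indicator (G v (p a)) * indicator (G v (p b))
    boundary-punchIn : boundaryProduct (p a) (p b) (p c) (p d) ≡ boundaryProduct a b c d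
    boundary-punchIn rewrite δ-punchIn a c | δ-punchIn a d | δ-punchIn b c | δ-punchIn b d = refl
    cycle-punchIn : ∀ w → cycleCoefficient (p a) (p b) (p w) (p c) (p d) ≡ cycleCoefficient a b w c d
    cycle-punchIn w rewrite δ-punchIn c a | δ-punchIn d b | δ-punchIn c b | δ-punchIn d w | δ-punchIn c w | δ-punchIn d a = refl
    cycle-through-v : cycleCoefficient (p a) (p b) v (p c) (p d) ≡ orientation c d a b
    cycle-through-v rewrite δ-punchIn c a | δ-punchIn d b | δ-punchIn c b | δ-punchIn d a | δ-punchIn-v c | δ-punchIn-v d =
      drop-v (δ c a) (δ d b) (δ c b) (δ d a)
      where
      drop-v : ∀ ca db cb da → ca * db + cb * 0ℤ + 0ℤ * da - cb * da - 0ℤ * db - ca * 0ℤ ≡ ca * db - cb * da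
      drop-v = solve-∀
    reorder : ∀ x y z → x + (y + z) ≡ x + z + y
    reorder = solve-∀

  module WhenDominating (dominating : Dominating G v) where
    G-v-punchIn : ∀ x → Adj G v (p x)
    G-v-punchIn x = dominating (p x) (Finₚ.punchInᵢ≢i v x)

    G-punchIn-v : ∀ x → Adj G (p x) v
    G-punchIn-v x = trans (symmetric (p x) v) (G-v-punchIn x)

    helmholtzEntry-star : ∀ u w → helmholtzEntry G (p u) v (p w) v ≡ onesPlusLaplacian G′ u w + 1ℤ * δ u w
    helmholtzEntry-star u w = begin
      boundaryProduct (p u) v (p w) v + trianglePart G (p u) v (p w) v
        ≡⟨ cong₂ _+_ boundary (trans (sumFin-punchIn n v (λ x → indicator (G x (p u)) * indicator (G x v) * cycleCoefficient (p u) v x (p w) v))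
             (cong₂ _+_ through-v (sumFin-cong n through-punchIn))) ⟩
      (δ u w - 0ℤ - 0ℤ + 1ℤ) + (0ℤ + sumFin n (λ y → δ w u * indicator (G′ u y) + - (δ w y * indicator (G′ y u))))
        ≡⟨ cong (λ s → (δ u w - 0ℤ - 0ℤ + 1ℤ) + (0ℤ + s)) (trans (sumFin-+ n (λ y → δ w u * indicator (G′ u y)) (λ y → - (δ w y * indicator (G′ y u))))
             (cong₂ _+_ (sumFin-*ˡ n (δ w u) (λ y → indicator (G′ u y))) (trans (sumFin-neg n (λ y → δ w y * indicator (G′ y u))) (cong -_ (sumFin-δˡ n w (λ y → indicator (G′ y u))))))) ⟩
      (δ u w - 0ℤ - 0ℤ + 1ℤ) + (0ℤ + (δ w u * degree G′ u + - indicator (G′ w u)))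
        ≡⟨ cong₂ (λ s e → (δ u w - 0ℤ - 0ℤ + 1ℤ) + (0ℤ + (s * degree G′ u + - indicator e))) (δ-sym w u) (symmetric (p w) (p u)) ⟩
      (δ u w - 0ℤ - 0ℤ + 1ℤ) + (0ℤ + (δ u w * degree G′ u + - indicator (G′ u w)))
        ≡⟨ regroup (δ u w) (degree G′ u) (indicator (G′ u w)) ⟩
      onesPlusLaplacian G′ u w + 1ℤ * δ u w ∎
      where
      open ≡-Reasoning
      boundary : boundaryProduct (p u) v (p w) v ≡ δ u w - 0ℤ - 0ℤ + 1ℤ
      boundary rewrite δ-punchIn u w | δ-punchIn-v u | δ-v-punchIn w | δ-refl v = refl
      through-v : indicator (G v (p u)) * indicator (G v v) * cycleCoefficient (p u) v v (p w) v ≡ 0ℤ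
      through-v rewrite irreflexive v = trans (cong (_* cycleCoefficient (p u) v v (p w) v) (ℤₚ.*-zeroʳ (indicator (G v (p u))))) refl
      through-punchIn : ∀ y → indicator (G (p y) (p u)) * indicator (G (p y) v) * cycleCoefficient (p u) v (p y) (p w) v
                              ≡ δ w u * indicator (G′ u y) + - (δ w y * indicator (G′ y u))
      through-punchIn y rewrite G-punchIn-v y | δ-punchIn w u | δ-punchIn w y | δ-punchIn-v w | δ-v-punchIn y | δ-v-punchIn u | δ-refl v
                              | symmetric (p y) (p u) = simplify (indicator (G′ u y)) (δ w u) (δ w y)
        where
        simplify : ∀ g a b → g * 1ℤ * (a * 1ℤ + 0ℤ * 0ℤ + b * 0ℤ - 0ℤ * 0ℤ - b * 1ℤ - a * 0ℤ) ≡ a * g + - (b * g)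
        simplify = solve-∀
      regroup : ∀ d g i → (d - 0ℤ - 0ℤ + 1ℤ) + (0ℤ + (d * g + - i)) ≡ 1ℤ + (g * d - i) + 1ℤ * d
      regroup = solve-∀

    helmholtzEntry-mixed : ∀ a b u → helmholtzEntry G (p a) (p b) (p u) v ≡ 0ℤ
    helmholtzEntry-mixed a b u = begin
      boundaryProduct (p a) (p b) (p u) v + trianglePart G (p a) (p b) (p u) v
        ≡⟨ cong₂ _+_ boundary (trans (sumFin-punchIn n v (λ x → indicator (G x (p a)) * indicator (G x (p b)) * cycleCoefficient (p a) (p b) x (p u) v))
             (cong₂ _+_ through-v (sumFin-0 n through-punchIn))) ⟩
      (δ a u - 0ℤ - δ b u + 0ℤ) + ((δ u b - δ u a) + 0ℤ)
        ≡⟨ cong₂ (λ s t → (δ a u - 0ℤ - δ b u + 0ℤ) + ((s - t) + 0ℤ)) (δ-sym u b) (δ-sym u a) ⟩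
      (δ a u - 0ℤ - δ b u + 0ℤ) + ((δ b u - δ a u) + 0ℤ)
        ≡⟨ cancel (δ a u) (δ b u) ⟩
      0ℤ ∎
      where
      open ≡-Reasoning
      boundary : boundaryProduct (p a) (p b) (p u) v ≡ δ a u - 0ℤ - δ b u + 0ℤ
      boundary rewrite δ-punchIn a u | δ-punchIn b u | δ-punchIn-v a | δ-punchIn-v b = refl
      through-v : indicator (G v (p a)) * indicator (G v (p b)) * cycleCoefficient (p a) (p b) v (p u) v ≡ δ u b - δ u a
      through-v rewrite G-v-punchIn a | G-v-punchIn b | δ-punchIn u a | δ-punchIn u b | δ-punchIn-v u | δ-v-punchIn a | δ-v-punchIn b | δ-refl v =
        simplify (δ u a) (δ u b)
        where
        simplify : ∀ x y → 1ℤ * 1ℤ * (x * 0ℤ + y * 1ℤ + 0ℤ * 0ℤ - y * 0ℤ - 0ℤ * 0ℤ - x * 1ℤ) ≡ y - x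
        simplify = solve-∀
      through-punchIn : ∀ y → indicator (G (p y) (p a)) * indicator (G (p y) (p b)) * cycleCoefficient (p a) (p b) (p y) (p u) v ≡ 0ℤ
      through-punchIn y rewrite δ-v-punchIn a | δ-v-punchIn b | δ-v-punchIn y =
        vanish (indicator (G (p y) (p a))) (indicator (G (p y) (p b))) (δ (p u) (p a)) (δ (p u) (p b)) (δ (p u) (p y))
        where
        vanish : ∀ g₁ g₂ x y z → g₁ * g₂ * (x * 0ℤ + y * 0ℤ + z * 0ℤ - y * 0ℤ - z * 0ℤ - x * 0ℤ) ≡ 0ℤ
        vanish = solve-∀
      cancel : ∀ x y → (x - 0ℤ - y + 0ℤ) + ((y - x) + 0ℤ) ≡ 0ℤ
      cancel = solve-∀

    reduced-laplacian : reduceAt v (laplacian G) ≗ᴹ λ k i → onesPlusLaplacian G′ k i + 1ℤ * δ k i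
    reduced-laplacian k i rewrite degree-punchIn k | G-punchIn-v k | G-v-punchIn i | δ-punchIn k i | δ-v-punchIn i =
      regroup (degree G′ k) (δ k i) (indicator (G′ k i)) (degree G v)
      where
      regroup : ∀ d e g D → (1ℤ + d) * e - g - (D * 0ℤ - 1ℤ) ≡ 1ℤ + (d * e - g) + 1ℤ * e
      regroup = solve-∀

    reduced-onesPlusLaplacian : reduceAt v (onesPlusLaplacian G) ≗ᴹ λ k i → onesPlusLaplacian G′ k i + 1ℤ * δ k i
    reduced-onesPlusLaplacian k i = trans (cancel-ones (laplacian G (p k) (p i)) (laplacian G v (p i))) (reduced-laplacian k i)
      where
      cancel-ones : ∀ x y → 1ℤ + x - (1ℤ + y) ≡ x - y
      cancel-ones = solve-∀

  module WhenIsolated (isolated : Isolated G v) where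
    reduced-laplacian : reduceAt v (laplacian G) ≗ᴹ laplacian G′
    reduced-laplacian k i rewrite degree-punchIn k | symmetric (p k) v | isolated (p k) | isolated (p i) | δ-punchIn k i | δ-v-punchIn i =
      regroup (degree G′ k) (δ k i) (indicator (G′ k i)) (degree G v)
      where
      regroup : ∀ d e g D → (0ℤ + d) * e - g - (D * 0ℤ - 0ℤ) ≡ d * e - g
      regroup = solve-∀

    reduced-onesPlusLaplacian : reduceAt v (onesPlusLaplacian G) ≗ᴹ laplacian G′
    reduced-onesPlusLaplacian k i = trans (cancel-ones (laplacian G (p k) (p i)) (laplacian G v (p i))) (reduced-laplacian k i)
      where
      cancel-ones : ∀ x y → 1ℤ + x - (1ℤ + y) ≡ x - y
      cancel-ones = solve-∀

    helmholtzEntry-isolated : ∀ a b c d → helmholtzEntry G (p a) (p b) (p c) (p d) ≡ helmholtzEntry G′ a b c d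
    helmholtzEntry-isolated a b c d rewrite helmholtzEntry-punchIn a b c d | isolated (p a) = ℤₚ.+-identityʳ _

-- Induction on the number of vertices

data SplitView (a d : ℕ) : Fin (a ℕ.+ d) → Set where
  left : ∀ i → SplitView a d (i ↑ˡ d)
  right : ∀ j → SplitView a d (a ↑ʳ j)

splitView : ∀ a d k → SplitView a d k
splitView zero d k = right k
splitView (suc a) d zero = left zero
splitView (suc a) d (suc k) with splitView a d k
... | left i = left (suc i)
... | right j = right j

module DominatingVertex {n} {G : Graph (suc n)} (simple : IsSimpleGraph G) {v} (dominating : Dominating G v)
                        {m} {ed : Fin m → Edge n} (E : IsEdgeEnumeration (deleteVertex G v) m ed) where
  open VertexDeletion G simple v
  open WhenDominating dominating
  private
    module E = IsEdgeEnumeration E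
    p : Fin n → Fin (suc n)
    p = punchIn v

    lifted : Fin m → Edge (suc n)
    lifted i = p (proj₁ (ed i)) , p (proj₂ (ed i))

    star : Fin n → Edge (suc n)
    star u = p u , v

  extended : Fin (m ℕ.+ n) → Edge (suc n)
  extended = lifted ++ star

  private
    extended-left : ∀ i → extended (i ↑ˡ n) ≡ lifted i
    extended-left = lookup-++ˡ lifted star
    extended-right : ∀ u → extended (m ↑ʳ u) ≡ star u
    extended-right = lookup-++ʳ lifted star

    adjacent : ∀ k → Adj G (proj₁ (extended k)) (proj₂ (extended k))
    adjacent k with splitView m n k
    ... | left i rewrite extended-left i = E.adjacent i
    ... | right u rewrite extended-right u = G-punchIn-v u

    covering : ∀ a b → Adj G a b → Σ (Fin (m ℕ.+ n)) λ k → SameEdge (extended k) (a , b)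
    covering a b Gab with v ≟ a | v ≟ b
    ... | yes refl | yes refl = ⊥-elim (adj⇒≢ simple Gab refl)
    ... | yes refl | no v≢b = m ↑ʳ punchOut v≢b ,
      subst (λ e → SameEdge e (a , b)) (sym (extended-right _)) (inj₂ (Finₚ.punchIn-punchOut v≢b , refl))
    ... | no v≢a | yes refl = m ↑ʳ punchOut v≢a ,
      subst (λ e → SameEdge e (a , b)) (sym (extended-right _)) (inj₁ (Finₚ.punchIn-punchOut v≢a , refl))
    ... | no v≢a | no v≢b = i ↑ˡ n , subst (λ e → SameEdge e (a , b)) (sym (extended-left i)) (lift (proj₂ found))
      where
      pa : p (punchOut v≢a) ≡ a
      pa = Finₚ.punchIn-punchOut v≢a
      pb : p (punchOut v≢b) ≡ b
      pb = Finₚ.punchIn-punchOut v≢b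
      found : Σ (Fin m) λ i → SameEdge (ed i) (punchOut v≢a , punchOut v≢b)
      found = E.covering (punchOut v≢a) (punchOut v≢b) (trans (cong₂ G pa pb) Gab)
      i : Fin m
      i = proj₁ found
      lift : SameEdge (ed i) (punchOut v≢a , punchOut v≢b) → SameEdge (lifted i) (a , b)
      lift (inj₁ (e₁ , e₂)) = inj₁ (trans (cong p e₁) pa , trans (cong p e₂) pb)
      lift (inj₂ (e₁ , e₂)) = inj₂ (trans (cong p e₁) pb , trans (cong p e₂) pa)

    p-injective : ∀ {x y} → p x ≡ p y → x ≡ y
    p-injective = Finₚ.punchIn-injective v _ _

    p≢v : ∀ {x} → p x ≢ v
    p≢v = Finₚ.punchInᵢ≢i v _

    unique : ∀ k k′ → SameEdge (extended k) (extended k′) → k ≡ k′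
    unique k k′ same with splitView m n k | splitView m n k′
    ... | left i | left j = cong (_↑ˡ n) (E.unique i j (unlift (subst₂ SameEdge (extended-left i) (extended-left j) same)))
      where
      unlift : SameEdge (lifted i) (lifted j) → SameEdge (ed i) (ed j)
      unlift (inj₁ (e₁ , e₂)) = inj₁ (p-injective e₁ , p-injective e₂)
      unlift (inj₂ (e₁ , e₂)) = inj₂ (p-injective e₁ , p-injective e₂)
    ... | left i | right u = ⊥-elim (not-star (subst₂ SameEdge (extended-left i) (extended-right u) same))
      where
      not-star : ¬ SameEdge (lifted i) (star u)
      not-star (inj₁ (_ , e₂)) = p≢v e₂
      not-star (inj₂ (e₁ , _)) = p≢v e₁
    ... | right u | left i = ⊥-elim (not-star (subst₂ SameEdge (extended-right u) (extended-left i) same))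
      where
      not-star : ¬ SameEdge (star u) (lifted i)
      not-star (inj₁ (_ , e₂)) = p≢v (sym e₂)
      not-star (inj₂ (_ , e₂)) = p≢v (sym e₂)
    ... | right u | right w = cong (m ↑ʳ_) (same-star (subst₂ SameEdge (extended-right u) (extended-right w) same))
      where
      same-star : SameEdge (star u) (star w) → u ≡ w
      same-star (inj₁ (e₁ , _)) = p-injective e₁
      same-star (inj₂ (e₁ , _)) = ⊥-elim (p≢v e₁)

  extended-isEdgeEnumeration : IsEdgeEnumeration G (m ℕ.+ n) extended
  extended-isEdgeEnumeration = record { adjacent = adjacent ; covering = covering ; unique = unique }

  -- Ordered this way the Helmholtzian is block lower triangular, with diagonal
  -- blocks 𝓗(G − v) + I and J + L(G − v) + I.
  integral-extended : AllEigenvaluesIntegral m (helmholtzianOf G′ ed) → AllEigenvaluesIntegral n (onesPlusLaplacian G′) →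
    AllEigenvaluesIntegral (m ℕ.+ n) (helmholtzianOf G extended)
  integral-extended integralH integralK = integral-blockLowerTriangular m n (helmholtzianOf G extended) upper-right
    (integral-cong m upper-left (integral-shift m (helmholtzianOf G′ ed) 1ℤ integralH))
    (integral-cong n lower-right (integral-shift n (onesPlusLaplacian G′) 1ℤ integralK))
    where
    upper-right : UpperRightZero m n (helmholtzianOf G extended)
    upper-right i u rewrite extended-left i | extended-right u = helmholtzEntry-mixed (proj₁ (ed i)) (proj₂ (ed i)) u
    upper-left : ∀ i j → helmholtzianOf G′ ed i j + 1ℤ * δ i j ≡ upperLeft m n (helmholtzianOf G extended) i j
    upper-left i j rewrite extended-left i | extended-left j
      | helmholtzEntry-punchIn (proj₁ (ed i)) (proj₂ (ed i)) (proj₁ (ed j)) (proj₂ (ed j))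
      | G-v-punchIn (proj₁ (ed i)) | G-v-punchIn (proj₂ (ed i)) =
      cong (λ o → helmholtzianOf G′ ed i j + 1ℤ * o) (sym (EdgeEnumeration.edgeOrientation-δ (deleteVertex-simple G v simple) E i j))
    lower-right : ∀ u w → onesPlusLaplacian G′ u w + 1ℤ * δ u w ≡ lowerRight m n (helmholtzianOf G extended) u w
    lower-right u w rewrite extended-right u | extended-right w = sym (helmholtzEntry-star u w)

module IsolatedVertex {n} {G : Graph (suc n)} (simple : IsSimpleGraph G) {v} (isolated : Isolated G v)
                      {m} {ed : Fin m → Edge (suc n)} (E : IsEdgeEnumeration G m ed) where
  open VertexDeletion G simple v
  open WhenIsolated isolated
  private
    module E = IsEdgeEnumeration E
    p : Fin n → Fin (suc n)
    p = punchIn v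

    v≢tail : ∀ i → v ≢ proj₁ (ed i)
    v≢tail i refl with () ← trans (sym (E.adjacent i)) (isolated _)
    v≢head : ∀ i → v ≢ proj₂ (ed i)
    v≢head i refl with () ← trans (sym (E.adjacent i)) (trans (proj₁ simple _ _) (isolated _))

    p-tail : ∀ i → p (punchOut (v≢tail i)) ≡ proj₁ (ed i)
    p-tail i = Finₚ.punchIn-punchOut (v≢tail i)
    p-head : ∀ i → p (punchOut (v≢head i)) ≡ proj₂ (ed i)
    p-head i = Finₚ.punchIn-punchOut (v≢head i)

  restricted : Fin m → Edge n
  restricted i = punchOut (v≢tail i) , punchOut (v≢head i)

  restricted-isEdgeEnumeration : IsEdgeEnumeration G′ m restricted
  restricted-isEdgeEnumeration = record
    { adjacent = λ i → trans (cong₂ G (p-tail i) (p-head i)) (E.adjacent i)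
    ; covering = covering
    ; unique = unique
    }
    where
    punchOut-p : ∀ {x y} (v≢x : v ≢ x) → x ≡ p y → punchOut v≢x ≡ y
    punchOut-p v≢x x≡py = trans (Finₚ.punchOut-cong v x≡py) (Finₚ.punchOut-punchIn v)
    covering : ∀ a b → Adj G′ a b → Σ (Fin m) λ i → SameEdge (restricted i) (a , b)
    covering a b G′ab with E.covering (p a) (p b) G′ab
    ... | i , inj₁ (e₁ , e₂) = i , inj₁ (punchOut-p (v≢tail i) e₁ , punchOut-p (v≢head i) e₂)
    ... | i , inj₂ (e₁ , e₂) = i , inj₂ (punchOut-p (v≢tail i) e₁ , punchOut-p (v≢head i) e₂)
    unique : ∀ i j → SameEdge (restricted i) (restricted j) → i ≡ j
    unique i j (inj₁ (e₁ , e₂)) = E.unique i j (inj₁ (trans (sym (p-tail i)) (trans (cong p e₁) (p-tail j)) , trans (sym (p-head i)) (trans (cong p e₂) (p-head j))))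
    unique i j (inj₂ (e₁ , e₂)) = E.unique i j (inj₂ (trans (sym (p-tail i)) (trans (cong p e₁) (p-head j)) , trans (sym (p-head i)) (trans (cong p e₂) (p-tail j))))

  restricted-helmholtzian : helmholtzianOf G′ restricted ≗ᴹ helmholtzianOf G ed
  restricted-helmholtzian i j = trans (sym (helmholtzEntry-isolated _ _ _ _))
    (cong₂ (λ e f → helmholtzEdge G e f) (cong₂ _,_ (p-tail i) (p-head i)) (cong₂ _,_ (p-tail j) (p-head j)))

record IntegralSpectra (G : Graph n) : Set where
  field
    laplacian-integral : AllEigenvaluesIntegral n (laplacian G)
    onesPlusLaplacian-integral : AllEigenvaluesIntegral n (onesPlusLaplacian G)
    helmholtzian-integral : ∀ {m ed} → IsEdgeEnumeration G m ed → AllEigenvaluesIntegral m (helmholtzianOf G ed)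

integralSpectra-empty : (G : Graph 0) → IntegralSpectra G
integralSpectra-empty G = record
  { laplacian-integral = integral-empty (laplacian G)
  ; onesPlusLaplacian-integral = integral-empty (onesPlusLaplacian G)
  ; helmholtzian-integral = helmholtzian-integral
  }
  where
  helmholtzian-integral : ∀ {m ed} → IsEdgeEnumeration G m ed → AllEigenvaluesIntegral m (helmholtzianOf G ed)
  helmholtzian-integral {zero} {ed} _ = integral-empty (helmholtzianOf G ed)
  helmholtzian-integral {suc m} {ed} _ with () ← proj₁ (ed zero)

dominating-integralSpectra : ∀ {G : Graph (suc n)} (simple : IsSimpleGraph G) {v} → Dominating G v →
  IntegralSpectra (deleteVertex G v) → IntegralSpectra G
dominating-integralSpectra {n} {G} simple {v} dominating IH = record
  { laplacian-integral = ConstantRowSum.integral (laplacian G) 0ℤ v (laplacian-rowSum G)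
      (integral-cong n (λ k i → sym (reduced-laplacian k i)) reduced-integral)
  ; onesPlusLaplacian-integral = ConstantRowSum.integral (onesPlusLaplacian G) _ v (onesPlusLaplacian-rowSum G)
      (integral-cong n (λ k i → sym (reduced-onesPlusLaplacian k i)) reduced-integral)
  ; helmholtzian-integral = λ E → integral-reenumerate simple E D.extended-isEdgeEnumeration
      (D.integral-extended (IH.helmholtzian-integral edges′) IH.onesPlusLaplacian-integral)
  }
  where
  open VertexDeletion G simple v
  open WhenDominating dominating
  module IH = IntegralSpectra IH
  reduced-integral : AllEigenvaluesIntegral n (λ k i → onesPlusLaplacian G′ k i + 1ℤ * δ k i)
  reduced-integral = integral-shift n (onesPlusLaplacian G′) 1ℤ IH.onesPlusLaplacian-integral
  edges′ : IsEdgeEnumeration G′ (nE G′) (EdgeList.edge G′ (deleteVertex-simple G v simple))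
  edges′ = EdgeList.edges-isEdgeEnumeration G′ (deleteVertex-simple G v simple)
  module D = DominatingVertex simple dominating edges′

isolated-integralSpectra : ∀ {G : Graph (suc n)} (simple : IsSimpleGraph G) {v} → Isolated G v →
  IntegralSpectra (deleteVertex G v) → IntegralSpectra G
isolated-integralSpectra {n} {G} simple {v} isolated IH = record
  { laplacian-integral = ConstantRowSum.integral (laplacian G) 0ℤ v (laplacian-rowSum G)
      (integral-cong n (λ k i → sym (reduced-laplacian k i)) IH.laplacian-integral)
  ; onesPlusLaplacian-integral = ConstantRowSum.integral (onesPlusLaplacian G) _ v (onesPlusLaplacian-rowSum G)
      (integral-cong n (λ k i → sym (reduced-onesPlusLaplacian k i)) IH.laplacian-integral)
  ; helmholtzian-integral = λ {m} E → integral-cong m (IsolatedVertex.restricted-helmholtzian simple isolated E)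
      (IH.helmholtzian-integral (IsolatedVertex.restricted-isEdgeEnumeration simple isolated E))
  }
  where
  open VertexDeletion G simple v
  open WhenIsolated isolated
  module IH = IntegralSpectra IH

threshold-integralSpectra : ∀ n (G : Graph n) → IsSimpleGraph G → IsThreshold G → IntegralSpectra G
threshold-integralSpectra zero G _ _ = integralSpectra-empty G
threshold-integralSpectra (suc n) G simple threshold = by-deleting (dominating-or-isolated G simple threshold)
  where
  IH : ∀ v → IntegralSpectra (deleteVertex G v)
  IH v = threshold-integralSpectra n (deleteVertex G v) (deleteVertex-simple G v simple) (deleteVertex-threshold G v threshold)
  by-deleting : Σ (Fin (suc n)) (λ v → Dominating G v ⊎ Isolated G v) → IntegralSpectra G
  by-deleting (v , inj₁ dominating) = dominating-integralSpectra simple dominating (IH v)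
  by-deleting (v , inj₂ isolated) = isolated-integralSpectra simple isolated (IH v)

corollary3p26 : ∀ (n : ℕ) (G : Graph n) → IsSimpleGraph G → IsThreshold G →
    HasEdge G → IsHIntegral G
corollary3p26 n G simple threshold _ = integral-cong (nE G) (λ i j → sym (helmholtzian-coordinates G simple i j))
  (IntegralSpectra.helmholtzian-integral (threshold-integralSpectra n G simple threshold) (EdgeList.edges-isEdgeEnumeration G simple))
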